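{- The $\mathbb{Q}$-vector space $\mathcal{MD}^\sharp$, spanned by $1$ and all brackets $[s_1,\dots,s_l]$ with $l\ge 1$ and $s_1,\dots,s_l \ge 2$, coincides with $Z(\{Q^E_s\}_{s},\mathbb{N}_{>1})$ and is a $\mathbb{Q}$-subalgebra of $\mathcal{MD}$.
   Context: The Eulerian polynomials $P_{s-1}(t)$, $s\ge 1$, are defined by $\frac{t P_{s-1}(t)}{(1-t)^s} = \sum_{d=1}^\infty d^{s-1} t^d$. For $s\ge 1$ put $Q^E_s(t) = \frac{1}{(s-1)!}\, t\, P_{s-1}(t)$. For $s_1,\dots,s_l \in \mathbb{N}=\{1,2,\dots\}$ define the bracket \[ [s_1,\dots,s_l] := \sum_{n_1>\dots>n_l>0}\prod_{j=1}^l \frac{Q^E_{s_j}(q^{n_j})}{(1-q^{n_j})^{s_j}} \in \mathbb{Q}[[q]], \] with the empty bracket equal to $1$. For a set $S\subset\mathbb{N}$ let $Z(\{Q^E_s\}_s,S)$ be the $\mathbb{Q}$-span of all brackets $[s_1,\dots,s_l]$ with $l\ge0$ and all $s_i\in S$. Let $\mathcal{MD}=Z(\{Q^E_s\}_s,\mathbb{N})$, the $\mathbb{Q}$-span of all brackets; it is a $\mathbb{Q}$-algebra under multiplication of power series. -}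

module Defs where

open import Data.Nat as ℕ using (ℕ; zero; suc; _∸_; _^_; _≤_; _≤ᵇ_; _!)
open import Data.Nat.Properties using (_!≢0)
import Data.Integer as ℤ
open import Data.Rational using (ℚ; 0ℚ; 1ℚ; _+_; _*_; _/_)
open import Data.Bool using (if_then_else_)
open import Data.List using (List; []; _∷_; length; foldr)
open import Data.List.Relation.Unary.All using (All)
open import Data.Product using (Σ; _×_; _,_; ∃)
open import Data.Sum using (_⊎_)
open import Relation.Binary.PropositionalEquality using (_≡_)

PowerSeries : Set
PowerSeries = ℕ → ℚ

_≈ₚ_ : PowerSeries → PowerSeries → Set
f ≈ₚ g = ∀ N → f N ≡ g N

sum1 : ℕ → (ℕ → ℚ) → ℚ
sum1 zero    f = 0ℚ
sum1 (suc k) f = sum1 k f + f (suc k)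

sum0 : ℕ → (ℕ → ℚ) → ℚ
sum0 k f = f 0 + sum1 k f

oneₚ : PowerSeries
oneₚ zero    = 1ℚ
oneₚ (suc _) = 0ℚ

_+ₚ_ : PowerSeries → PowerSeries → PowerSeries
(f +ₚ g) N = f N + g N

_·ₚ_ : ℚ → PowerSeries → PowerSeries
(c ·ₚ f) N = c * f N

_*ₚ_ : PowerSeries → PowerSeries → PowerSeries
(f *ₚ g) N = sum0 N (λ i → f i * g (N ∸ i))

zeroₚ : PowerSeries
zeroₚ _ = 0ℚ

-- Q^E_s(t)/(1-t)^s = (1/(s-1)!) t P_{s-1}(t)/(1-t)^s = Σ_{d≥1} (d^{s-1}/(s-1)!) t^d
-- by the defining identity of the Eulerian polynomials.  coefQE s d is the
-- coefficient of t^d (d ≥ 1).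
coefQE : ℕ → ℕ → ℚ
coefQE s d = _/_ (ℤ.+ (d ^ (s ∸ 1))) ((s ∸ 1) !) {{(s ∸ 1) !≢0}}

-- C ss m N = coefficient of q^N in
--   Σ_{m > n_1 > ... > n_l > 0} Π_j Q^E_{s_j}(q^{n_j}) / (1 - q^{n_j})^{s_j}
-- i.e. the sum over n_j and d_j ≥ 1 with Σ n_j d_j = N of Π d_j^{s_j-1}/(s_j-1)!.
C : List ℕ → ℕ → ℕ → ℚ
C []       m N = oneₚ N
C (s ∷ ss) m N =
  sum1 (m ∸ 1) (λ n →
    sum1 N (λ d →
      if (n ℕ.* d) ≤ᵇ N then coefQE s d * C ss n (N ∸ (n ℕ.* d)) else 0ℚ))

-- The bracket [s_1,...,s_l].  Terms with n_1 > N contribute nothing to the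
-- coefficient of q^N (since n_1 d_1 ≥ n_1), so restricting to n_1 < N + 1 is exact.
bracket : List ℕ → PowerSeries
bracket ss N = C ss (suc N) N

linComb : List (ℚ × PowerSeries) → PowerSeries
linComb = foldr (λ { (c , g) acc → (c ·ₚ g) +ₚ acc }) zeroₚ

Span : (PowerSeries → Set) → PowerSeries → Set
Span G f = Σ (List (ℚ × PowerSeries)) λ cs →
  All (λ { (c , g) → G g }) cs × (f ≈ₚ linComb cs)

Z : (ℕ → Set) → PowerSeries → Set
Z S = Span (λ g → Σ (List ℕ) λ ss → All S ss × (g ≈ₚ bracket ss))

Positive : ℕ → Set
Positive s = 1 ≤ s

GreaterOne : ℕ → Set
GreaterOne s = 2 ≤ s

-- MD = Z({Q^E_s}_s, ℕ) with ℕ = {1,2,...}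
MD : PowerSeries → Set
MD = Z Positive

MDsharp : PowerSeries → Set
MDsharp = Span (λ g → (g ≈ₚ oneₚ) ⊎
  (Σ (List ℕ) λ ss → (1 ≤ length ss) × All GreaterOne ss × (g ≈ₚ bracket ss)))

module Submission where

-- Write g_s(x) = Q^E_s(x)/(1-x)^s = Σ_{d≥1} d^{s-1}/(s-1)! xᵈ.  Truncating the
-- outermost summation index of a bracket gives series C w m with
--   C (s ∷ w) (m+1) = C (s ∷ w) m + g_s(q^m) · C w m,
-- so products of truncated brackets obey the stuffle (quasi-shuffle) recursion
-- as soon as g_s g_t is a ℚ-combination of the g_u with u ≥ 2.  This product
-- formula holds because the d-th coefficient of g_s g_t is a constant times
-- Σ_{0<a<d} a^{s-1}(d-a)^{t-1}, a polynomial in d (Faulhaber) vanishing at 0.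

open import Defs
open import Data.Nat as ℕ using (ℕ; zero; suc; _∸_; _≤_; _<_; z≤n; s≤s; _^_; _!; _≤ᵇ_)
import Data.Nat.Properties as ℕP
import Data.Integer as ℤ
import Data.Integer.Properties as ℤP
open import Data.Rational using (ℚ; 0ℚ; 1ℚ; _+_; _*_; _-_; -_; fromℚᵘ)
import Data.Rational as ℚ
import Data.Rational.Properties as ℚP
import Data.Rational.Unnormalised as U
import Data.Rational.Unnormalised.Properties as UP
open import Data.Vec using (Vec; []; _∷_; replicate; zipWith) renaming (map to Vmap)
open import Data.List using (List; []; _∷_; _++_; length)
open import Data.List.Relation.Unary.All using (All; []; _∷_)
import Data.List.Relation.Unary.All as All
import Data.List.Relation.Unary.All.Properties as AllP
open import Data.Product using (Σ; _,_; proj₁; proj₂; _×_)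
open import Data.Sum using (_⊎_; inj₁; inj₂)
open import Data.Bool using (Bool; true; false; T; if_then_else_)
open import Data.Maybe using (Maybe; nothing; just)
open import Data.Empty using (⊥-elim)
open import Relation.Nullary using (yes; no; ¬_)
open import Tactic.RingSolver using (solve-∀)
open import Tactic.RingSolver.Core.AlmostCommutativeRing using (AlmostCommutativeRing; fromCommutativeRing)
open import Relation.Binary.PropositionalEquality
open ≡-Reasoning

ℚ-ring : AlmostCommutativeRing _ _
ℚ-ring = fromCommutativeRing ℚP.+-*-commutativeRing isZero
  where
  isZero : (x : ℚ) → Maybe (0ℚ ≡ x)
  isZero x with 0ℚ ℚP.≟ x
  ... | yes p = just p
  ... | no _  = nothing

-- Finite sums Σ_{i<n} f i, with the rearrangement lemmas used throughout.

Σ< : ℕ → (ℕ → ℚ) → ℚ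
Σ< zero    f = 0ℚ
Σ< (suc n) f = Σ< n f + f n

sum1≡Σ< : ∀ k f → sum1 k f ≡ Σ< k (λ i → f (suc i))
sum1≡Σ< zero    f = refl
sum1≡Σ< (suc k) f = cong (_+ f (suc k)) (sum1≡Σ< k f)

Σ<-head : ∀ k f → Σ< (suc k) f ≡ f 0 + Σ< k (λ i → f (suc i))
Σ<-head zero    f = trans (ℚP.+-identityˡ (f 0)) (sym (ℚP.+-identityʳ (f 0)))
Σ<-head (suc k) f = begin
  (Σ< (suc k) f) + f (suc k)                 ≡⟨ cong (_+ f (suc k)) (Σ<-head k f) ⟩
  (f 0 + Σ< k (λ i → f (suc i))) + f (suc k) ≡⟨ ℚP.+-assoc (f 0) _ _ ⟩
  f 0 + (Σ< k (λ i → f (suc i)) + f (suc k)) ∎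

sum0≡Σ< : ∀ k f → sum0 k f ≡ Σ< (suc k) f
sum0≡Σ< k f = trans (cong (f 0 +_) (sum1≡Σ< k f)) (sym (Σ<-head k f))

Σ<-cong : ∀ n {f g} → (∀ i → i < n → f i ≡ g i) → Σ< n f ≡ Σ< n g
Σ<-cong zero    h = refl
Σ<-cong (suc n) h = cong₂ _+_ (Σ<-cong n (λ i i<n → h i (ℕP.m<n⇒m<1+n i<n))) (h n ℕP.≤-refl)

Σ<-zero : ∀ n {f} → (∀ i → i < n → f i ≡ 0ℚ) → Σ< n f ≡ 0ℚ
Σ<-zero zero    h = refl
Σ<-zero (suc n) h =
  trans (cong₂ _+_ (Σ<-zero n (λ i i<n → h i (ℕP.m<n⇒m<1+n i<n))) (h n ℕP.≤-refl)) (ℚP.+-identityˡ 0ℚ)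

Σ<-+ : ∀ n f g → Σ< n (λ i → f i + g i) ≡ Σ< n f + Σ< n g
Σ<-+ zero    f g = refl
Σ<-+ (suc n) f g = begin
  Σ< n (λ i → f i + g i) + (f n + g n) ≡⟨ cong (_+ (f n + g n)) (Σ<-+ n f g) ⟩
  (Σ< n f + Σ< n g) + (f n + g n)      ≡⟨ interchange (Σ< n f) (Σ< n g) (f n) (g n) ⟩
  (Σ< n f + f n) + (Σ< n g + g n)      ∎
  where
  interchange : ∀ a b c d → (a + b) + (c + d) ≡ (a + c) + (b + d)
  interchange = solve-∀ ℚ-ring

Σ<-- : ∀ n f g → Σ< n (λ i → f i - g i) ≡ Σ< n f - Σ< n g
Σ<-- zero    f g = refl
Σ<-- (suc n) f g = trans (cong (_+ (f n - g n)) (Σ<-- n f g)) (interchange (Σ< n f) (Σ< n g) (f n) (g n))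
  where
  interchange : ∀ a b c d → (a - b) + (c - d) ≡ (a + c) - (b + d)
  interchange = solve-∀ ℚ-ring

Σ<-*ˡ : ∀ n c f → c * Σ< n f ≡ Σ< n (λ i → c * f i)
Σ<-*ˡ zero    c f = ℚP.*-zeroʳ c
Σ<-*ˡ (suc n) c f = trans (ℚP.*-distribˡ-+ c (Σ< n f) (f n)) (cong (_+ c * f n) (Σ<-*ˡ n c f))

Σ<-*ʳ : ∀ n c f → Σ< n f * c ≡ Σ< n (λ i → f i * c)
Σ<-*ʳ n c f = trans (ℚP.*-comm (Σ< n f) c) (trans (Σ<-*ˡ n c f) (Σ<-cong n (λ i _ → ℚP.*-comm c (f i))))

Σ<-product : ∀ A B (F G : ℕ → ℚ) → Σ< A F * Σ< B G ≡ Σ< A (λ a → Σ< B (λ b → F a * G b))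
Σ<-product A B F G = trans (Σ<-*ʳ A (Σ< B G) F) (Σ<-cong A (λ a _ → Σ<-*ˡ B (F a) G))

Σ<-split : ∀ m k f → Σ< (m ℕ.+ k) f ≡ Σ< m f + Σ< k (λ i → f (m ℕ.+ i))
Σ<-split m zero    f = trans (cong (λ x → Σ< x f) (ℕP.+-identityʳ m)) (sym (ℚP.+-identityʳ _))
Σ<-split m (suc k) f = begin
  Σ< (m ℕ.+ suc k) f                                   ≡⟨ cong (λ x → Σ< x f) (ℕP.+-suc m k) ⟩
  Σ< (m ℕ.+ k) f + f (m ℕ.+ k)                         ≡⟨ cong (_+ f (m ℕ.+ k)) (Σ<-split m k f) ⟩
  (Σ< m f + Σ< k (λ i → f (m ℕ.+ i))) + f (m ℕ.+ k)    ≡⟨ ℚP.+-assoc (Σ< m f) _ _ ⟩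
  Σ< m f + (Σ< k (λ i → f (m ℕ.+ i)) + f (m ℕ.+ k))    ∎

Σ<-extend : ∀ N M f → N ≤ M → (∀ i → N ≤ i → i < M → f i ≡ 0ℚ) → Σ< M f ≡ Σ< N f
Σ<-extend N M f N≤M vanish = begin
  Σ< M f                                     ≡⟨ cong (λ k → Σ< k f) (sym (ℕP.m+[n∸m]≡n N≤M)) ⟩
  Σ< (N ℕ.+ (M ∸ N)) f                       ≡⟨ Σ<-split N (M ∸ N) f ⟩
  Σ< N f + Σ< (M ∸ N) (λ i → f (N ℕ.+ i))    ≡⟨ cong (Σ< N f +_) (Σ<-zero (M ∸ N) tail0) ⟩
  Σ< N f + 0ℚ                                ≡⟨ ℚP.+-identityʳ _ ⟩
  Σ< N f                                     ∎
  where
  tail0 : ∀ i → i < M ∸ N → f (N ℕ.+ i) ≡ 0ℚ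
  tail0 i i<M-N = vanish (N ℕ.+ i) (ℕP.m≤m+n N i)
    (subst (N ℕ.+ i <_) (ℕP.m+[n∸m]≡n N≤M) (ℕP.+-monoʳ-< N i<M-N))

Σ<-swap : ∀ a b (f : ℕ → ℕ → ℚ) → Σ< a (λ i → Σ< b (f i)) ≡ Σ< b (λ j → Σ< a (λ i → f i j))
Σ<-swap zero    b f = sym (Σ<-zero b (λ _ _ → refl))
Σ<-swap (suc a) b f = begin
  Σ< a (λ i → Σ< b (f i)) + Σ< b (f a)               ≡⟨ cong (_+ Σ< b (f a)) (Σ<-swap a b f) ⟩
  Σ< b (λ j → Σ< a (λ i → f i j)) + Σ< b (f a)       ≡⟨ Σ<-+ b _ _ ⟨
  Σ< b (λ j → Σ< a (λ i → f i j) + f a j)            ∎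

Σ<-triangle : ∀ N (F : ℕ → ℕ → ℚ) →
  Σ< (suc N) (λ i → Σ< (suc i) (F i)) ≡ Σ< (suc N) (λ j → Σ< (suc (N ∸ j)) (λ k → F (j ℕ.+ k) j))
Σ<-triangle zero    F = refl
Σ<-triangle (suc N) F = begin
  Σ< (suc N) (λ i → Σ< (suc i) (F i)) + Σ< (suc (suc N)) (F (suc N))
    ≡⟨ cong (_+ Σ< (suc (suc N)) (F (suc N))) (Σ<-triangle N F) ⟩
  Old + (Σ< (suc N) (F (suc N)) + F (suc N) (suc N))
    ≡⟨ ℚP.+-assoc Old (Σ< (suc N) (F (suc N))) (F (suc N) (suc N)) ⟨
  (Old + Σ< (suc N) (F (suc N))) + F (suc N) (suc N)
    ≡⟨ cong₂ _+_ (trans (sym (Σ<-+ (suc N) _ _)) (Σ<-cong (suc N) column)) corner ⟩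
  Σ< (suc N) (λ j → Σ< (suc (suc N ∸ j)) (λ k → F (j ℕ.+ k) j)) + Σ< (suc (suc N ∸ suc N)) (λ k → F (suc N ℕ.+ k) (suc N)) ∎
  where
  Old = Σ< (suc N) (λ j → Σ< (suc (N ∸ j)) (λ k → F (j ℕ.+ k) j))
  -- each column j ≤ N gains the single new term F (N+1) j
  column : ∀ j → j < suc N →
    Σ< (suc (N ∸ j)) (λ k → F (j ℕ.+ k) j) + F (suc N) j ≡ Σ< (suc (suc N ∸ j)) (λ k → F (j ℕ.+ k) j)
  column j j<sN
    rewrite ℕP.+-∸-assoc 1 (ℕP.≤-pred j<sN)
    = cong (λ x → Σ< (suc (N ∸ j)) (λ k → F (j ℕ.+ k) j) + F x j)
        (sym (trans (ℕP.+-suc j (N ∸ j)) (cong suc (ℕP.m+[n∸m]≡n (ℕP.≤-pred j<sN)))))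
  -- and the new column N+1 consists of the single term F (N+1) (N+1)
  corner : F (suc N) (suc N) ≡ Σ< (suc (suc N ∸ suc N)) (λ k → F (suc N ℕ.+ k) (suc N))
  corner rewrite ℕP.n∸n≡0 N | ℕP.+-identityʳ N = sym (ℚP.+-identityˡ _)

Σ<-reverse : ∀ n f → Σ< n f ≡ Σ< n (λ i → f (n ∸ suc i))
Σ<-reverse zero    f = refl
Σ<-reverse (suc n) f = begin
  Σ< n f + f n                       ≡⟨ cong (_+ f n) (Σ<-reverse n f) ⟩
  Σ< n (λ i → f (n ∸ suc i)) + f n   ≡⟨ ℚP.+-comm _ (f n) ⟩
  f n + Σ< n (λ i → f (n ∸ suc i))   ≡⟨ Σ<-head n (λ i → f (suc n ∸ suc i)) ⟨
  Σ< (suc n) (λ i → f (suc n ∸ suc i)) ∎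

telescope : ∀ d (g : ℕ → ℚ) → Σ< d (λ a → g (suc a) - g a) ≡ g d - g 0
telescope zero    g = sym (ℚP.+-inverseʳ (g 0))
telescope (suc d) g = trans (cong (_+ (g (suc d) - g d)) (telescope d g)) (collapse (g (suc d)) (g d) (g 0))
  where
  collapse : ∀ x y z → (y - z) + (x - y) ≡ x - z
  collapse = solve-∀ ℚ-ring

Σ<-single : ∀ n x {f} → x < n → (∀ i → i < n → ¬ (i ≡ x) → f i ≡ 0ℚ) → Σ< n f ≡ f x
Σ<-single (suc n) x {f} x<sn others with x ℕP.≟ n
... | yes refl = trans (cong (_+ f x) (Σ<-zero n (λ i i<n → others i (ℕP.m<n⇒m<1+n i<n) (λ e → ℕP.<-irrefl e i<n))))
                       (ℚP.+-identityˡ (f x))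
... | no x≢n   = trans (cong₂ _+_ (Σ<-single n x (ℕP.≤∧≢⇒< (ℕP.≤-pred x<sn) x≢n) (λ i i<n → others i (ℕP.m<n⇒m<1+n i<n)))
                                  (others n ℕP.≤-refl (λ e → x≢n (sym e))))
                       (ℚP.+-identityʳ (f x))

-- Kronecker delta on ℕ.  It is kept opaque so that sums of deltas are only
-- ever evaluated through the two lemmas below.
opaque
  δ : ℕ → ℕ → ℚ
  δ x y with x ℕP.≟ y
  ... | yes _ = 1ℚ
  ... | no _  = 0ℚ

  δ-≡ : ∀ {x y} → x ≡ y → δ x y ≡ 1ℚ
  δ-≡ {x} {y} e with x ℕP.≟ y
  ... | yes _ = refl
  ... | no ne = ⊥-elim (ne e)

  δ-≢ : ∀ {x y} → ¬ (x ≡ y) → δ x y ≡ 0ℚ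
  δ-≢ {x} {y} ne with x ℕP.≟ y
  ... | yes e = ⊥-elim (ne e)
  ... | no _  = refl

Σ<-δ-in : ∀ M x (F : ℕ → ℚ) → x < M → Σ< M (λ i → δ x i * F i) ≡ F x
Σ<-δ-in M x F x<M =
  trans (Σ<-single M x x<M (λ i _ ne → trans (cong (_* F i) (δ-≢ (λ e → ne (sym e)))) (ℚP.*-zeroˡ (F i))))
        (trans (cong (_* F x) (δ-≡ refl)) (ℚP.*-identityˡ (F x)))

Σ<-δ-out : ∀ M x (F : ℕ → ℚ) → M ≤ x → Σ< M (λ i → δ x i * F i) ≡ 0ℚ
Σ<-δ-out M x F M≤x = Σ<-zero M (λ i i<M →
  trans (cong (_* F i) (δ-≢ (λ e → ℕP.<-irrefl (sym e) (ℕP.<-≤-trans i<M M≤x)))) (ℚP.*-zeroˡ (F i)))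

δ-shift : ∀ i j N → i ≤ N → δ (i ℕ.+ j) N ≡ δ (N ∸ i) j
δ-shift i j N i≤N with (i ℕ.+ j) ℕP.≟ N
... | yes e = trans (δ-≡ e) (sym (δ-≡ (trans (cong (_∸ i) (sym e)) (ℕP.m+n∸m≡n i j))))
... | no ne = trans (δ-≢ ne) (sym (δ-≢ (λ e → ne (trans (cong (i ℕ.+_) (sym e)) (ℕP.m+[n∸m]≡n i≤N)))))

≈ₚ-sym : ∀ {f g} → f ≈ₚ g → g ≈ₚ f
≈ₚ-sym p N = sym (p N)

≈ₚ-trans : ∀ {f g h} → f ≈ₚ g → g ≈ₚ h → f ≈ₚ h
≈ₚ-trans p q N = trans (p N) (q N)

+ₚ-cong : ∀ {f f' g g'} → f ≈ₚ f' → g ≈ₚ g' → (f +ₚ g) ≈ₚ (f' +ₚ g')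
+ₚ-cong p q N = cong₂ _+_ (p N) (q N)

*ₚ-coeff : ∀ f g N → (f *ₚ g) N ≡ Σ< (suc N) (λ i → f i * g (N ∸ i))
*ₚ-coeff f g N = sum0≡Σ< N _

*ₚ-cong : ∀ {f f' g g'} → f ≈ₚ f' → g ≈ₚ g' → (f *ₚ g) ≈ₚ (f' *ₚ g')
*ₚ-cong {f} {f'} {g} {g'} p q N = begin
  (f *ₚ g) N                             ≡⟨ *ₚ-coeff f g N ⟩
  Σ< (suc N) (λ i → f i * g (N ∸ i))     ≡⟨ Σ<-cong (suc N) (λ i _ → cong₂ _*_ (p i) (q (N ∸ i))) ⟩
  Σ< (suc N) (λ i → f' i * g' (N ∸ i))   ≡⟨ *ₚ-coeff f' g' N ⟨
  (f' *ₚ g') N                           ∎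

*ₚ-comm : ∀ f g → (f *ₚ g) ≈ₚ (g *ₚ f)
*ₚ-comm f g N = begin
  (f *ₚ g) N                                           ≡⟨ *ₚ-coeff f g N ⟩
  Σ< (suc N) (λ i → f i * g (N ∸ i))                   ≡⟨ Σ<-reverse (suc N) _ ⟩
  Σ< (suc N) (λ i → f (N ∸ i) * g (N ∸ (N ∸ i)))       ≡⟨ Σ<-cong (suc N) flip ⟩
  Σ< (suc N) (λ i → g i * f (N ∸ i))                   ≡⟨ *ₚ-coeff g f N ⟨
  (g *ₚ f) N                                           ∎
  where
  flip : ∀ i → i < suc N → f (N ∸ i) * g (N ∸ (N ∸ i)) ≡ g i * f (N ∸ i)
  flip i i<sN rewrite ℕP.m∸[m∸n]≡n (ℕP.≤-pred i<sN) = ℚP.*-comm (f (N ∸ i)) (g i)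

*ₚ-assoc : ∀ f g h → ((f *ₚ g) *ₚ h) ≈ₚ (f *ₚ (g *ₚ h))
*ₚ-assoc f g h N = begin
  ((f *ₚ g) *ₚ h) N
    ≡⟨ *ₚ-coeff (f *ₚ g) h N ⟩
  Σ< (suc N) (λ i → (f *ₚ g) i * h (N ∸ i))
    ≡⟨ Σ<-cong (suc N) (λ i _ → trans (cong (_* h (N ∸ i)) (*ₚ-coeff f g i)) (Σ<-*ʳ (suc i) _ _)) ⟩
  Σ< (suc N) (λ i → Σ< (suc i) (λ j → f j * g (i ∸ j) * h (N ∸ i)))
    ≡⟨ Σ<-triangle N _ ⟩
  Σ< (suc N) (λ j → Σ< (suc (N ∸ j)) (λ k → f j * g ((j ℕ.+ k) ∸ j) * h (N ∸ (j ℕ.+ k))))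
    ≡⟨ Σ<-cong (suc N) (λ j _ → Σ<-cong (suc (N ∸ j)) (λ k _ → reindex j k)) ⟩
  Σ< (suc N) (λ j → Σ< (suc (N ∸ j)) (λ k → f j * (g k * h ((N ∸ j) ∸ k))))
    ≡⟨ Σ<-cong (suc N) (λ j _ → trans (sym (Σ<-*ˡ (suc (N ∸ j)) (f j) _)) (cong (f j *_) (sym (*ₚ-coeff g h (N ∸ j))))) ⟩
  Σ< (suc N) (λ j → f j * (g *ₚ h) (N ∸ j))
    ≡⟨ *ₚ-coeff f (g *ₚ h) N ⟨
  (f *ₚ (g *ₚ h)) N ∎
  where
  reindex : ∀ j k → f j * g ((j ℕ.+ k) ∸ j) * h (N ∸ (j ℕ.+ k)) ≡ f j * (g k * h ((N ∸ j) ∸ k))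
  reindex j k rewrite ℕP.m+n∸m≡n j k | ℕP.∸-+-assoc N j k = ℚP.*-assoc (f j) (g k) _

*ₚ-distribˡ : ∀ f g h → (f *ₚ (g +ₚ h)) ≈ₚ ((f *ₚ g) +ₚ (f *ₚ h))
*ₚ-distribˡ f g h N = begin
  (f *ₚ (g +ₚ h)) N                                          ≡⟨ *ₚ-coeff f (g +ₚ h) N ⟩
  Σ< (suc N) (λ i → f i * (g (N ∸ i) + h (N ∸ i)))           ≡⟨ Σ<-cong (suc N) (λ i _ → ℚP.*-distribˡ-+ (f i) _ _) ⟩
  Σ< (suc N) (λ i → f i * g (N ∸ i) + f i * h (N ∸ i))       ≡⟨ Σ<-+ (suc N) _ _ ⟩
  Σ< (suc N) (λ i → f i * g (N ∸ i)) + Σ< (suc N) (λ i → f i * h (N ∸ i))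
    ≡⟨ cong₂ _+_ (*ₚ-coeff f g N) (*ₚ-coeff f h N) ⟨
  ((f *ₚ g) +ₚ (f *ₚ h)) N                                   ∎

*ₚ-distribʳ : ∀ f g h → ((g +ₚ h) *ₚ f) ≈ₚ ((g *ₚ f) +ₚ (h *ₚ f))
*ₚ-distribʳ f g h =
  ≈ₚ-trans (*ₚ-comm (g +ₚ h) f) (≈ₚ-trans (*ₚ-distribˡ f g h) (+ₚ-cong (*ₚ-comm f g) (*ₚ-comm f h)))

*ₚ-scaleˡ : ∀ c f g → ((c ·ₚ f) *ₚ g) ≈ₚ (c ·ₚ (f *ₚ g))
*ₚ-scaleˡ c f g N = begin
  ((c ·ₚ f) *ₚ g) N                         ≡⟨ *ₚ-coeff (c ·ₚ f) g N ⟩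
  Σ< (suc N) (λ i → c * f i * g (N ∸ i))    ≡⟨ Σ<-cong (suc N) (λ i _ → ℚP.*-assoc c (f i) _) ⟩
  Σ< (suc N) (λ i → c * (f i * g (N ∸ i)))  ≡⟨ Σ<-*ˡ (suc N) c _ ⟨
  c * Σ< (suc N) (λ i → f i * g (N ∸ i))    ≡⟨ cong (c *_) (*ₚ-coeff f g N) ⟨
  (c ·ₚ (f *ₚ g)) N                         ∎

*ₚ-scaleʳ : ∀ c f g → (f *ₚ (c ·ₚ g)) ≈ₚ (c ·ₚ (f *ₚ g))
*ₚ-scaleʳ c f g N = trans (*ₚ-comm f (c ·ₚ g) N) (trans (*ₚ-scaleˡ c g f N) (cong (c *_) (*ₚ-comm g f N)))

*ₚ-identityˡ : ∀ f → (oneₚ *ₚ f) ≈ₚ f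
*ₚ-identityˡ f N = trans (*ₚ-coeff oneₚ f N) (trans (Σ<-single (suc N) 0 (s≤s z≤n) higher) (ℚP.*-identityˡ (f N)))
  where
  higher : ∀ i → i < suc N → ¬ (i ≡ 0) → oneₚ i * f (N ∸ i) ≡ 0ℚ
  higher zero    _ i≢0 = ⊥-elim (i≢0 refl)
  higher (suc i) _ _   = ℚP.*-zeroˡ (f (N ∸ suc i))

*ₚ-identityʳ : ∀ f → (f *ₚ oneₚ) ≈ₚ f
*ₚ-identityʳ f = ≈ₚ-trans (*ₚ-comm f oneₚ) (*ₚ-identityˡ f)

*ₚ-zeroˡ : ∀ f → (zeroₚ *ₚ f) ≈ₚ zeroₚ
*ₚ-zeroˡ f N = trans (*ₚ-coeff zeroₚ f N) (Σ<-zero (suc N) (λ i _ → ℚP.*-zeroˡ (f (N ∸ i))))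

*ₚ-zeroʳ : ∀ f → (f *ₚ zeroₚ) ≈ₚ zeroₚ
*ₚ-zeroʳ f = ≈ₚ-trans (*ₚ-comm f zeroₚ) (*ₚ-zeroˡ f)

-- The coefficient of q^N in f g as a sum over the box [0,M]² of exponents,
-- picked out by δ; this form is convenient for substitutions x ↦ x^n.
*ₚ-box : ∀ f g N M → N ≤ M →
  (f *ₚ g) N ≡ Σ< (suc M) (λ i → Σ< (suc M) (λ j → δ (i ℕ.+ j) N * (f i * g j)))
*ₚ-box f g N M N≤M = sym (begin
  Σ< (suc M) (λ i → Σ< (suc M) (λ j → δ (i ℕ.+ j) N * (f i * g j)))
    ≡⟨ Σ<-extend (suc N) (suc M) _ (s≤s N≤M) rowsBeyondN ⟩
  Σ< (suc N) (λ i → Σ< (suc M) (λ j → δ (i ℕ.+ j) N * (f i * g j)))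
    ≡⟨ Σ<-cong (suc N) row ⟩
  Σ< (suc N) (λ i → f i * g (N ∸ i))
    ≡⟨ *ₚ-coeff f g N ⟨
  (f *ₚ g) N ∎)
  where
  rowsBeyondN : ∀ i → suc N ≤ i → i < suc M → Σ< (suc M) (λ j → δ (i ℕ.+ j) N * (f i * g j)) ≡ 0ℚ
  rowsBeyondN i N<i _ = Σ<-zero (suc M) (λ j _ →
    trans (cong (_* (f i * g j)) (δ-≢ (λ e → ℕP.<-irrefl (sym e) (ℕP.<-≤-trans N<i (ℕP.m≤m+n i j)))))
          (ℚP.*-zeroˡ (f i * g j)))
  row : ∀ i → i < suc N → Σ< (suc M) (λ j → δ (i ℕ.+ j) N * (f i * g j)) ≡ f i * g (N ∸ i)
  row i i<sN = trans (Σ<-cong (suc M) (λ j _ → cong (_* (f i * g j)) (δ-shift i j N (ℕP.≤-pred i<sN))))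
    (Σ<-δ-in (suc M) (N ∸ i) (λ j → f i * g j) (s≤s (ℕP.≤-trans (ℕP.m∸n≤m N i) N≤M)))

fromℚᵘ-+ : ∀ p q → fromℚᵘ (p U.+ q) ≡ fromℚᵘ p + fromℚᵘ q
fromℚᵘ-+ p q = ℚP.toℚᵘ-injective (UP.≃-trans (ℚP.toℚᵘ-fromℚᵘ (p U.+ q))
  (UP.≃-sym (UP.≃-trans (ℚP.toℚᵘ-homo-+ (fromℚᵘ p) (fromℚᵘ q)) (UP.+-cong (ℚP.toℚᵘ-fromℚᵘ p) (ℚP.toℚᵘ-fromℚᵘ q)))))

fromℚᵘ-* : ∀ p q → fromℚᵘ (p U.* q) ≡ fromℚᵘ p * fromℚᵘ q
fromℚᵘ-* p q = ℚP.toℚᵘ-injective (UP.≃-trans (ℚP.toℚᵘ-fromℚᵘ (p U.* q))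
  (UP.≃-sym (UP.≃-trans (ℚP.toℚᵘ-homo-* (fromℚᵘ p) (fromℚᵘ q)) (UP.*-cong (ℚP.toℚᵘ-fromℚᵘ p) (ℚP.toℚᵘ-fromℚᵘ q)))))

-- ι is opaque: all later reasoning goes through its homomorphism laws, which
-- keeps normalisation of ring-solver goals cheap.
opaque
  ι : ℕ → ℚ
  ι n = fromℚᵘ (U.mkℚᵘ (ℤ.+ n) 0)

  ι-+ : ∀ a b → ι (a ℕ.+ b) ≡ ι a + ι b
  ι-+ a b = trans (ℚP.fromℚᵘ-cong {U.mkℚᵘ (ℤ.+ (a ℕ.+ b)) 0} {A U.+ B} (U.*≡* eq)) (fromℚᵘ-+ A B)
    where
    A B : U.ℚᵘ
    A = U.mkℚᵘ (ℤ.+ a) 0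
    B = U.mkℚᵘ (ℤ.+ b) 0
    eq : ℤ.+ (a ℕ.+ b) ℤ.* ℤ.+ 1 ≡ (ℤ.+ a ℤ.* ℤ.+ 1 ℤ.+ ℤ.+ b ℤ.* ℤ.+ 1) ℤ.* ℤ.+ 1
    eq rewrite ℤP.*-identityʳ (ℤ.+ (a ℕ.+ b)) | ℤP.*-identityʳ (ℤ.+ a) | ℤP.*-identityʳ (ℤ.+ b)
             | ℤP.*-identityʳ (ℤ.+ a ℤ.+ ℤ.+ b) = ℤP.pos-+ a b

  ι-* : ∀ a b → ι (a ℕ.* b) ≡ ι a * ι b
  ι-* a b = trans (ℚP.fromℚᵘ-cong {U.mkℚᵘ (ℤ.+ (a ℕ.* b)) 0} {A U.* B} (U.*≡* (cong (ℤ._* ℤ.+ 1) (ℤP.pos-* a b))))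
                  (fromℚᵘ-* A B)
    where
    A B : U.ℚᵘ
    A = U.mkℚᵘ (ℤ.+ a) 0
    B = U.mkℚᵘ (ℤ.+ b) 0

  ι0 : ι 0 ≡ 0ℚ
  ι0 = refl

  ι1 : ι 1 ≡ 1ℚ
  ι1 = refl

  /-ι : ∀ x m → .{{_ : ℕ.NonZero m}} → (ℤ.+ x ℚ./ m) * ι m ≡ ι x
  /-ι x (suc m) = trans (sym (fromℚᵘ-* (U.mkℚᵘ (ℤ.+ x) m) (U.mkℚᵘ (ℤ.+ suc m) 0))) (ℚP.fromℚᵘ-cong {U.mkℚᵘ (ℤ.+ x) m U.* U.mkℚᵘ (ℤ.+ suc m) 0} {U.mkℚᵘ (ℤ.+ x) 0} (U.*≡* eq))
    where
    eq : (ℤ.+ x ℤ.* ℤ.+ suc m) ℤ.* ℤ.+ 1 ≡ ℤ.+ x ℤ.* ℤ.+ suc (m ℕ.* 1)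
    eq = trans (ℤP.*-identityʳ _) (cong (λ k → ℤ.+ x ℤ.* ℤ.+ suc k) (sym (ℕP.*-identityʳ m)))

ι-suc : ∀ a → ι (suc a) ≡ 1ℚ + ι a
ι-suc a = trans (ι-+ 1 a) (cong (_+ ι a) ι1)

ι-^ : ∀ a k → ι (a ^ suc k) ≡ ι a * ι (a ^ k)
ι-^ a k = ι-* a (a ^ k)

ι-1^ : ∀ k → ι (1 ^ k) ≡ 1ℚ
ι-1^ k = trans (cong ι (ℕP.^-zeroˡ k)) ι1

ι-∸ : ∀ a b → b ≤ a → ι (a ∸ b) ≡ ι a - ι b
ι-∸ a b b≤a = begin
  ι (a ∸ b)                ≡⟨ addSub (ι (a ∸ b)) (ι b) ⟩
  (ι (a ∸ b) + ι b) - ι b  ≡⟨ cong (_- ι b) (ι-+ (a ∸ b) b) ⟨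
  ι (a ∸ b ℕ.+ b) - ι b    ≡⟨ cong (λ x → ι x - ι b) (ℕP.m∸n+n≡m b≤a) ⟩
  ι a - ι b                ∎
  where
  addSub : ∀ x y → x ≡ (x + y) - y
  addSub = solve-∀ ℚ-ring

inv : ℕ → ℚ
inv n = ℤ.+ 1 ℚ./ suc n

inv-ι : ∀ n → inv n * ι (suc n) ≡ 1ℚ
inv-ι n = trans (/-ι 1 (suc n)) ι1

solve-ι : ∀ n S X → ι (suc n) * S ≡ X → S ≡ inv n * X
solve-ι n S X e = begin
  S                          ≡⟨ ℚP.*-identityˡ S ⟨
  1ℚ * S                     ≡⟨ cong (_* S) (inv-ι n) ⟨
  (inv n * ι (suc n)) * S    ≡⟨ ℚP.*-assoc (inv n) _ S ⟩
  inv n * (ι (suc n) * S)    ≡⟨ cong (inv n *_) e ⟩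
  inv n * X                  ∎

-- Polynomial functions ℕ → ℚ and Faulhaber's theorem.

-- evalPoly (c_{n-1} ∷ … ∷ c_0 ∷ []) d = Σ_k c_k d^k.
evalPoly : ∀ {n} → Vec ℚ n → ℕ → ℚ
evalPoly {zero}  []      d = 0ℚ
evalPoly {suc n} (c ∷ v) d = c * ι (d ^ n) + evalPoly v d

-- f is a polynomial function of degree < n.
IsPoly : ℕ → (ℕ → ℚ) → Set
IsPoly n f = Σ (Vec ℚ n) λ v → ∀ d → f d ≡ evalPoly v d

IsPoly-ext : ∀ {n f g} → (∀ d → f d ≡ g d) → IsPoly n f → IsPoly n g
IsPoly-ext e (v , p) = v , λ d → trans (sym (e d)) (p d)

evalPoly-zero : ∀ n d → evalPoly (replicate n 0ℚ) d ≡ 0ℚ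
evalPoly-zero zero    d = refl
evalPoly-zero (suc n) d = trans (cong₂ _+_ (ℚP.*-zeroˡ (ι (d ^ n))) (evalPoly-zero n d)) (ℚP.+-identityˡ 0ℚ)

IsPoly-zero : ∀ n {f} → (∀ d → f d ≡ 0ℚ) → IsPoly n f
IsPoly-zero n h = replicate n 0ℚ , λ d → trans (h d) (sym (evalPoly-zero n d))

IsPoly-monomial : ∀ n → IsPoly (suc n) (λ d → ι (d ^ n))
IsPoly-monomial n = (1ℚ ∷ replicate n 0ℚ) , λ d →
  sym (trans (cong₂ _+_ (ℚP.*-identityˡ (ι (d ^ n))) (evalPoly-zero n d)) (ℚP.+-identityʳ _))

IsPoly-+ : ∀ {n f g} → IsPoly n f → IsPoly n g → IsPoly n (λ d → f d + g d)
IsPoly-+ (u , p) (v , q) = zipWith _+_ u v , λ d → trans (cong₂ _+_ (p d) (q d)) (sym (eval-+ u v d))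
  where
  distrib : ∀ a b x y z → (a + b) * x + (y + z) ≡ (a * x + y) + (b * x + z)
  distrib = solve-∀ ℚ-ring
  eval-+ : ∀ {n} (u v : Vec ℚ n) d → evalPoly (zipWith _+_ u v) d ≡ evalPoly u d + evalPoly v d
  eval-+ []      []      d = sym (ℚP.+-identityˡ 0ℚ)
  eval-+ {suc n} (a ∷ u) (b ∷ v) d =
    trans (cong ((a + b) * ι (d ^ n) +_) (eval-+ u v d)) (distrib a b (ι (d ^ n)) (evalPoly u d) (evalPoly v d))

IsPoly-scale : ∀ {n f} c → IsPoly n f → IsPoly n (λ d → c * f d)
IsPoly-scale c (v , p) = Vmap (c *_) v , λ d → trans (cong (c *_) (p d)) (sym (eval-scale v d))
  where
  distrib : ∀ c a x y → c * a * x + c * y ≡ c * (a * x + y)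
  distrib = solve-∀ ℚ-ring
  eval-scale : ∀ {n} (v : Vec ℚ n) d → evalPoly (Vmap (c *_) v) d ≡ c * evalPoly v d
  eval-scale []      d = sym (ℚP.*-zeroʳ c)
  eval-scale {suc n} (a ∷ v) d =
    trans (cong (c * a * ι (d ^ n) +_) (eval-scale v d)) (distrib c a (ι (d ^ n)) (evalPoly v d))

IsPoly-neg : ∀ {n f} → IsPoly n f → IsPoly n (λ d → - f d)
IsPoly-neg {n} {f} p = IsPoly-ext (λ d → neg (f d)) (IsPoly-scale (- 1ℚ) p)
  where
  neg : ∀ x → (- 1ℚ) * x ≡ - x
  neg = solve-∀ ℚ-ring

IsPoly-- : ∀ {n f g} → IsPoly n f → IsPoly n g → IsPoly n (λ d → f d - g d)
IsPoly-- p q = IsPoly-+ p (IsPoly-neg q)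

IsPoly-weaken : ∀ {n f} → IsPoly n f → IsPoly (suc n) f
IsPoly-weaken {n} (v , p) = (0ℚ ∷ v) , λ d →
  trans (p d) (sym (trans (cong (_+ evalPoly v d) (ℚP.*-zeroˡ (ι (d ^ n)))) (ℚP.+-identityˡ _)))

IsPoly-weakenBy : ∀ k {n f} → IsPoly n f → IsPoly (k ℕ.+ n) f
IsPoly-weakenBy zero    p = p
IsPoly-weakenBy (suc k) p = IsPoly-weaken (IsPoly-weakenBy k p)

IsPoly-*d : ∀ {n f} → IsPoly n f → IsPoly (suc n) (λ d → ι d * f d)
IsPoly-*d (v , p) = shift v , λ d → trans (cong (ι _ *_) (p d)) (sym (eval-shift v d))
  where
  shift : ∀ {n} → Vec ℚ n → Vec ℚ (suc n)
  shift []      = 0ℚ ∷ []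
  shift (c ∷ v) = c ∷ shift v
  distrib : ∀ c x y z → c * (x * y) + x * z ≡ x * (c * y + z)
  distrib = solve-∀ ℚ-ring
  eval-shift : ∀ {n} (v : Vec ℚ n) d → evalPoly (shift v) d ≡ ι d * evalPoly v d
  eval-shift []      d = trans (trans (cong (_+ 0ℚ) (ℚP.*-zeroˡ (ι 1))) (ℚP.+-identityˡ 0ℚ)) (sym (ℚP.*-zeroʳ (ι d)))
  eval-shift {suc n} (c ∷ v) d = begin
    c * ι (d ^ suc n) + evalPoly (shift v) d    ≡⟨ cong₂ (λ x y → c * x + y) (ι-^ d n) (eval-shift v d) ⟩
    c * (ι d * ι (d ^ n)) + ι d * evalPoly v d  ≡⟨ distrib c (ι d) (ι (d ^ n)) (evalPoly v d) ⟩
    ι d * (c * ι (d ^ n) + evalPoly v d)        ∎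

binomRest : ℕ → ℕ → ℚ
binomRest n a = ι (suc a ^ suc n) - ι (a ^ suc n) - ι (suc n) * ι (a ^ n)

binomRest-step : ∀ n a → ι (suc n) * ι (a ^ n) + (ι a * binomRest n a + binomRest n a) ≡ binomRest (suc n) a
binomRest-step n a = begin
  ι (suc n) * ι (a ^ n) + (ι a * binomRest n a + binomRest n a)
    ≡⟨ cong (λ x → ι (suc n) * ι (a ^ n) + (ι a * x + x)) (cong (λ x → ι (suc a ^ suc n) - x - ι (suc n) * ι (a ^ n)) (ι-^ a n)) ⟩
  K * Y + (A * (X - A * Y - K * Y) + (X - A * Y - K * Y))
    ≡⟨ expand A X Y K ⟩
  (1ℚ + A) * X - A * (A * Y) - (1ℚ + K) * (A * Y)
    ≡⟨ cong₂ _-_ (cong₂ _-_ (trans (ι-^ (suc a) (suc n)) (cong (_* X) (ι-suc a)))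
                            (trans (ι-^ a (suc n)) (cong (A *_) (ι-^ a n))))
                 (cong₂ _*_ (ι-suc (suc n)) (ι-^ a n)) ⟨
  binomRest (suc n) a ∎
  where
  A = ι a
  X = ι (suc a ^ suc n)
  Y = ι (a ^ n)
  K = ι (suc n)
  expand : ∀ A X Y K → K * Y + (A * (X - A * Y - K * Y) + (X - A * Y - K * Y))
                       ≡ (1ℚ + A) * X - A * (A * Y) - (1ℚ + K) * (A * Y)
  expand = solve-∀ ℚ-ring

binomRest-poly : ∀ n → IsPoly n (binomRest n)
binomRest-poly zero = IsPoly-zero 0 λ a → trans (unfold a) (vanish (ι a))
  where
  vanish : ∀ x → (1ℚ + x) * 1ℚ - x * 1ℚ - 1ℚ * 1ℚ ≡ 0ℚ
  vanish = solve-∀ ℚ-ring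
  unfold : ∀ a → binomRest 0 a ≡ (1ℚ + ι a) * 1ℚ - ι a * 1ℚ - 1ℚ * 1ℚ
  unfold a = cong₂ _-_ (cong₂ _-_ (trans (ι-* (suc a) 1) (cong₂ _*_ (ι-suc a) ι1))
                                  (trans (ι-* a 1) (cong (ι a *_) ι1)))
                       (cong₂ _*_ ι1 ι1)
binomRest-poly (suc n) = IsPoly-ext (binomRest-step n)
  (IsPoly-+ (IsPoly-scale (ι (suc n)) (IsPoly-monomial n))
            (IsPoly-+ (IsPoly-*d (binomRest-poly n)) (IsPoly-weaken (binomRest-poly n))))

-- Telescoping (a+1)^{n+1} - a^{n+1}:
--   (n+1) Σ_{a<d} a^n = d^{n+1} - Σ_{a<d} binomRest n a.
powerSum-identity : ∀ n d → ι (suc n) * Σ< d (λ a → ι (a ^ n)) ≡ ι (d ^ suc n) - Σ< d (binomRest n)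
powerSum-identity n d = begin
  K * S                                                ≡⟨ addSub K S Rest ⟩
  (Rest + K * S) - Rest                                ≡⟨ cong (_- Rest) (sym (trans (Σ<-+ d (binomRest n) _) (cong (Rest +_) (sym (Σ<-*ˡ d K _))))) ⟩
  Σ< d (λ a → binomRest n a + K * ι (a ^ n)) - Rest    ≡⟨ cong (_- Rest) (Σ<-cong d (λ a _ → cancel (ι (suc a ^ suc n)) (ι (a ^ suc n)) (K * ι (a ^ n)))) ⟩
  Σ< d (λ a → ι (suc a ^ suc n) - ι (a ^ suc n)) - Rest ≡⟨ cong (_- Rest) (telescope d (λ a → ι (a ^ suc n))) ⟩
  (ι (d ^ suc n) - ι 0) - Rest                         ≡⟨ cong (λ x → (ι (d ^ suc n) - x) - Rest) ι0 ⟩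
  (ι (d ^ suc n) - 0ℚ) - Rest                          ≡⟨ cong (_- Rest) (subZero (ι (d ^ suc n))) ⟩
  ι (d ^ suc n) - Rest                                 ∎
  where
  K = ι (suc n)
  S = Σ< d (λ a → ι (a ^ n))
  Rest = Σ< d (binomRest n)
  addSub : ∀ x y z → x * y ≡ (z + x * y) - z
  addSub = solve-∀ ℚ-ring
  cancel : ∀ x y z → (x - y - z) + z ≡ x - y
  cancel = solve-∀ ℚ-ring
  subZero : ∀ x → x - 0ℚ ≡ x
  subZero = solve-∀ ℚ-ring

faulhaber : ∀ n {f} → IsPoly n f → IsPoly (suc n) (λ d → Σ< d f)
faulhaber zero    {f} ([] , p)      = IsPoly-zero 1 (λ d → Σ<-zero d (λ a _ → p a))
faulhaber (suc n) {f} ((c ∷ v) , p) =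
  IsPoly-ext split (IsPoly-+ (IsPoly-scale c powerSum) (IsPoly-weaken (faulhaber n (v , λ _ → refl))))
  where
  powerSum : IsPoly (suc (suc n)) (λ d → Σ< d (λ a → ι (a ^ n)))
  powerSum = IsPoly-ext (λ d → sym (solve-ι n _ _ (powerSum-identity n d)))
    (IsPoly-scale (inv n) (IsPoly-- (IsPoly-monomial (suc n)) (IsPoly-weaken (faulhaber n (binomRest-poly n)))))
  split : ∀ d → c * Σ< d (λ a → ι (a ^ n)) + Σ< d (evalPoly v) ≡ Σ< d f
  split d = sym (trans (Σ<-cong d (λ a _ → p a))
                (trans (Σ<-+ d _ _) (cong (_+ Σ< d (evalPoly v)) (sym (Σ<-*ˡ d c _)))))

Poly : (ℕ → ℚ) → Set
Poly f = Σ ℕ λ n → IsPoly n f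

Poly-ext : ∀ {f g} → (∀ d → f d ≡ g d) → Poly f → Poly g
Poly-ext e (n , p) = n , IsPoly-ext e p

Poly-- : ∀ {f g} → Poly f → Poly g → Poly (λ d → f d - g d)
Poly-- {f} {g} (n , p) (m , q) =
  m ℕ.+ n , IsPoly-- (IsPoly-weakenBy m p) (subst (λ k → IsPoly k g) (ℕP.+-comm n m) (IsPoly-weakenBy n q))

Poly-*d : ∀ {f} → Poly f → Poly (λ d → ι d * f d)
Poly-*d (n , p) = suc n , IsPoly-*d p

monomialConv : ℕ → ℕ → ℕ → ℚ
monomialConv i j d = Σ< d (λ a → ι (a ^ i) * ι ((d ∸ a) ^ j))

-- (d-a)^{j+1} = d (d-a)^j - a (d-a)^j.
monomialConv-step : ∀ i j d → monomialConv i (suc j) d ≡ ι d * monomialConv i j d - monomialConv (suc i) j d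
monomialConv-step i j d = begin
  monomialConv i (suc j) d
    ≡⟨ Σ<-cong d (λ a a<d → term a (ℕP.<⇒≤ a<d)) ⟩
  Σ< d (λ a → ι d * (ι (a ^ i) * ι ((d ∸ a) ^ j)) - ι (a ^ suc i) * ι ((d ∸ a) ^ j))
    ≡⟨ Σ<-- d _ _ ⟩
  Σ< d (λ a → ι d * (ι (a ^ i) * ι ((d ∸ a) ^ j))) - monomialConv (suc i) j d
    ≡⟨ cong (_- monomialConv (suc i) j d) (sym (Σ<-*ˡ d (ι d) _)) ⟩
  ι d * monomialConv i j d - monomialConv (suc i) j d ∎
  where
  distrib : ∀ D A P Y → P * ((D - A) * Y) ≡ D * (P * Y) - (A * P) * Y
  distrib = solve-∀ ℚ-ring
  term : ∀ a → a ≤ d →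
    ι (a ^ i) * ι ((d ∸ a) ^ suc j) ≡ ι d * (ι (a ^ i) * ι ((d ∸ a) ^ j)) - ι (a ^ suc i) * ι ((d ∸ a) ^ j)
  term a a≤d = begin
    ι (a ^ i) * ι ((d ∸ a) ^ suc j)
      ≡⟨ cong (ι (a ^ i) *_) (trans (ι-^ (d ∸ a) j) (cong (_* ι ((d ∸ a) ^ j)) (ι-∸ d a a≤d))) ⟩
    ι (a ^ i) * ((ι d - ι a) * ι ((d ∸ a) ^ j))
      ≡⟨ distrib (ι d) (ι a) (ι (a ^ i)) (ι ((d ∸ a) ^ j)) ⟩
    ι d * (ι (a ^ i) * ι ((d ∸ a) ^ j)) - (ι a * ι (a ^ i)) * ι ((d ∸ a) ^ j)
      ≡⟨ cong (λ x → ι d * (ι (a ^ i) * ι ((d ∸ a) ^ j)) - x * ι ((d ∸ a) ^ j)) (sym (ι-^ a i)) ⟩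
    ι d * (ι (a ^ i) * ι ((d ∸ a) ^ j)) - ι (a ^ suc i) * ι ((d ∸ a) ^ j) ∎

opaque
  monomialConv-poly : ∀ j i → Poly (monomialConv i j)
  monomialConv-poly zero    i = Poly-ext (λ d → Σ<-cong d (λ a _ → times1 d a))
    (suc (suc i) , faulhaber (suc i) (IsPoly-monomial i))
    where
    times1 : ∀ d a → ι (a ^ i) ≡ ι (a ^ i) * ι ((d ∸ a) ^ 0)
    times1 d a = trans (sym (ℚP.*-identityʳ _)) (cong (ι (a ^ i) *_) (sym ι1))
  monomialConv-poly (suc j) i = Poly-ext (λ d → sym (monomialConv-step i j d))
    (Poly-- (Poly-*d (monomialConv-poly j i)) (monomialConv-poly j (suc i)))

-- The coefficients of g_s and the product formula g_s g_t = Σ c_u g_u.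

-- qe s d = d^{s-1}/(s-1)!, the coefficient of x^d in g_s(x) for d ≥ 1; an
-- opaque copy of coefQE, used only through the two facts below.
opaque
  qe : ℕ → ℕ → ℚ
  qe = coefQE

  coefQE≡qe : ∀ s d → coefQE s d ≡ qe s d
  coefQE≡qe s d = refl

  qe-ι : ∀ s d → qe s d * ι ((s ∸ 1) !) ≡ ι (d ^ (s ∸ 1))
  qe-ι s d = /-ι (d ^ (s ∸ 1)) ((s ∸ 1) !) {{(s ∸ 1) ℕP.!≢0}}

qe-factor : ∀ s a → qe s a ≡ ι (a ^ (s ∸ 1)) * qe s 1
qe-factor s a = begin
  qe s a                              ≡⟨ ℚP.*-identityʳ _ ⟨
  qe s a * 1ℚ                         ≡⟨ cong (qe s a *_) (sym (trans (qe-ι s 1) (ι-1^ (s ∸ 1)))) ⟩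
  qe s a * (qe s 1 * ι ((s ∸ 1) !))   ≡⟨ rearrange (qe s a) (qe s 1) (ι ((s ∸ 1) !)) ⟩
  (qe s a * ι ((s ∸ 1) !)) * qe s 1   ≡⟨ cong (_* qe s 1) (qe-ι s a) ⟩
  ι (a ^ (s ∸ 1)) * qe s 1            ∎
  where
  rearrange : ∀ x y z → x * (y * z) ≡ (x * z) * y
  rearrange = solve-∀ ℚ-ring

qe-at0 : ∀ k → qe (suc (suc k)) 0 ≡ 0ℚ
qe-at0 k = trans (qe-factor (suc (suc k)) 0) (trans (cong (_* qe (suc (suc k)) 1) ι0) (ℚP.*-zeroˡ (qe (suc (suc k)) 1)))

combQE : List (ℚ × ℕ) → ℕ → ℚ
combQE []            d = 0ℚ
combQE ((c , u) ∷ L) d = c * qe u d + combQE L d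

WeightGe2 : ℚ × ℕ → Set
WeightGe2 (_ , u) = 2 ≤ u

QECombination : (ℕ → ℚ) → Set
QECombination f = Σ (List (ℚ × ℕ)) λ L → All WeightGe2 L × (∀ d → f d ≡ combQE L d)

QECombination-scale : ∀ k {f} → QECombination f → QECombination (λ d → k * f d)
QECombination-scale k (L , A , e) = scaleL L , scaleL-All L A , λ d → trans (cong (k *_) (e d)) (sym (combQE-scale L d))
  where
  scaleL : List (ℚ × ℕ) → List (ℚ × ℕ)
  scaleL []            = []
  scaleL ((c , u) ∷ L) = (k * c , u) ∷ scaleL L
  scaleL-All : ∀ L → All WeightGe2 L → All WeightGe2 (scaleL L)
  scaleL-All []      []      = []
  scaleL-All (_ ∷ L) (g ∷ A) = g ∷ scaleL-All L A
  distrib : ∀ k c x y → (k * c) * x + k * y ≡ k * (c * x + y)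
  distrib = solve-∀ ℚ-ring
  combQE-scale : ∀ L d → combQE (scaleL L) d ≡ k * combQE L d
  combQE-scale []            d = sym (ℚP.*-zeroʳ k)
  combQE-scale ((c , u) ∷ L) d = trans (cong ((k * c) * qe u d +_) (combQE-scale L d)) (distrib k c (qe u d) (combQE L d))

-- A polynomial vanishing at 0 has no constant term, and d^{u-1} = (u-1)! qe u d,
-- so it is a combination of the qe u with u ≥ 2.
poly-vanishing-at-0 : ∀ {n} (v : Vec ℚ n) → evalPoly v 0 ≡ 0ℚ → QECombination (evalPoly v)
poly-vanishing-at-0 {zero}        []          _  = [] , [] , λ d → refl
poly-vanishing-at-0 {suc zero}    (c ∷ [])    v0 = [] , [] , λ d → v0
poly-vanishing-at-0 {suc (suc m)} (c ∷ v)     v0 with poly-vanishing-at-0 v lower0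
  where
  lower0 : evalPoly v 0 ≡ 0ℚ
  lower0 = trans (sym (trans (cong (λ x → c * x + evalPoly v 0) ι0)
                      (trans (cong (_+ evalPoly v 0) (ℚP.*-zeroʳ c)) (ℚP.+-identityˡ _)))) v0
... | L , A , e = (c * ι (suc m !) , suc (suc m)) ∷ L , s≤s (s≤s z≤n) ∷ A , λ d → cong₂ _+_ (leading d) (e d)
  where
  rearrange : ∀ x y z → x * (y * z) ≡ (x * z) * y
  rearrange = solve-∀ ℚ-ring
  leading : ∀ d → c * ι (d ^ suc m) ≡ (c * ι (suc m !)) * qe (suc (suc m)) d
  leading d = trans (cong (c *_) (sym (qe-ι (suc (suc m)) d))) (rearrange c _ _)

-- The product formula: for s, t ≥ 2 the convolution qe s ⋆ qe t is a
-- combination of qe u with u ≥ 2.  Indeed its d-th term is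
-- qe s 1 · qe t 1 · Σ_{0<a<d} a^{s-1}(d-a)^{t-1}, a polynomial in d that
-- vanishes at 0.  (Opaque: only the existence of the combination matters.)
opaque
  qe-convolution : ∀ k l → QECombination (qe (suc (suc k)) *ₚ qe (suc (suc l)))
  qe-convolution k l with monomialConv-poly (suc l) (suc k)
  ... | _ , v , conv≡v =
    QECombination-ext (QECombination-scale (cs * ct) (poly-vanishing-at-0 v (sym (conv≡v 0))))
    where
    s t : ℕ
    s = suc (suc k)
    t = suc (suc l)
    cs ct : ℚ
    cs = qe s 1
    ct = qe t 1
    rearrange : ∀ x y z w → (x * z) * (y * w) ≡ (z * w) * (x * y)
    rearrange = solve-∀ ℚ-ring
    -- the term a = d vanishes since qe t 0 = 0
    lastTerm : ∀ d → qe s d * qe t (d ∸ d) ≡ 0ℚ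
    lastTerm d rewrite ℕP.n∸n≡0 d = trans (cong (qe s d *_) (qe-at0 l)) (ℚP.*-zeroʳ (qe s d))
    convolution : ∀ d → (qe s *ₚ qe t) d ≡ (cs * ct) * evalPoly v d
    convolution d = begin
      (qe s *ₚ qe t) d
        ≡⟨ *ₚ-coeff (qe s) (qe t) d ⟩
      Σ< d (λ a → qe s a * qe t (d ∸ a)) + qe s d * qe t (d ∸ d)
        ≡⟨ cong₂ _+_ (Σ<-cong d (λ a _ → trans (cong₂ _*_ (qe-factor s a) (qe-factor t (d ∸ a)))
                                              (rearrange (ι (a ^ suc k)) (ι ((d ∸ a) ^ suc l)) cs ct)))
                     (lastTerm d) ⟩
      Σ< d (λ a → (cs * ct) * (ι (a ^ suc k) * ι ((d ∸ a) ^ suc l))) + 0ℚ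
        ≡⟨ ℚP.+-identityʳ _ ⟩
      Σ< d (λ a → (cs * ct) * (ι (a ^ suc k) * ι ((d ∸ a) ^ suc l)))
        ≡⟨ Σ<-*ˡ d (cs * ct) _ ⟨
      (cs * ct) * monomialConv (suc k) (suc l) d
        ≡⟨ cong ((cs * ct) *_) (conv≡v d) ⟩
      (cs * ct) * evalPoly v d ∎
    QECombination-ext : QECombination (λ d → (cs * ct) * evalPoly v d) → QECombination (qe s *ₚ qe t)
    QECombination-ext (L , A , e) = L , A , λ d → trans (convolution d) (e d)

-- Dilation φ(x) ↦ φ(x^n), which is multiplicative.

Σ<-swap₁₂ : ∀ A C D (F : ℕ → ℕ → ℕ → ℚ) →
  Σ< A (λ i → Σ< C (λ a → Σ< D (λ b → F i a b))) ≡ Σ< C (λ a → Σ< D (λ b → Σ< A (λ i → F i a b)))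
Σ<-swap₁₂ A C D F = trans (Σ<-swap A C _) (Σ<-cong C (λ a _ → Σ<-swap A D (λ i b → F i a b)))

Σ<-swap₂₂ : ∀ A B C D (F : ℕ → ℕ → ℕ → ℕ → ℚ) →
  Σ< A (λ i → Σ< B (λ j → Σ< C (λ a → Σ< D (λ b → F i j a b))))
  ≡ Σ< C (λ a → Σ< D (λ b → Σ< A (λ i → Σ< B (λ j → F i j a b))))
Σ<-swap₂₂ A B C D F =
  trans (Σ<-cong A (λ i _ → Σ<-swap₁₂ B C D (F i))) (Σ<-swap₁₂ A C D (λ i a b → Σ< B (λ j → F i j a b)))

Σ<²-*ˡ : ∀ A B c (F : ℕ → ℕ → ℚ) → c * Σ< A (λ a → Σ< B (F a)) ≡ Σ< A (λ a → Σ< B (λ b → c * F a b))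
Σ<²-*ˡ A B c F = trans (Σ<-*ˡ A c _) (Σ<-cong A (λ a _ → Σ<-*ˡ B c (F a)))

-- dilate n φ is the power series φ(q^n): its x-th coefficient is φ (x/n) if
-- n ∣ x and 0 otherwise.
dilate : ℕ → PowerSeries → PowerSeries
dilate n φ x = Σ< (suc x) (λ a → δ (n ℕ.* a) x * φ a)

dilate-cong : ∀ n {φ ψ} → φ ≈ₚ ψ → dilate n φ ≈ₚ dilate n ψ
dilate-cong n p x = Σ<-cong (suc x) (λ a _ → cong (δ (n ℕ.* a) x *_) (p a))

dilate-range : ∀ n φ x M → x ≤ M → dilate (suc n) φ x ≡ Σ< (suc M) (λ a → δ (suc n ℕ.* a) x * φ a)
dilate-range n φ x M x≤M = sym (Σ<-extend (suc x) (suc M) _ (s≤s x≤M) (λ a x<a _ →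
  trans (cong (_* φ a) (δ-≢ (λ e → ℕP.<-irrefl (sym e) (ℕP.<-≤-trans x<a (ℕP.m≤n*m a (suc n))))))
        (ℚP.*-zeroˡ (φ a))))

δ-box : ∀ N x y → Σ< (suc N) (λ i → Σ< (suc N) (λ j → δ x i * (δ y j * δ (i ℕ.+ j) N))) ≡ δ (x ℕ.+ y) N
δ-box N x y with y ℕP.<? suc N
... | yes y<sN = begin
  Σ< (suc N) (λ i → Σ< (suc N) (λ j → δ x i * (δ y j * δ (i ℕ.+ j) N)))
    ≡⟨ Σ<-cong (suc N) (λ i _ → trans (sym (Σ<-*ˡ (suc N) (δ x i) (λ j → δ y j * δ (i ℕ.+ j) N)))
                                      (cong (δ x i *_) (Σ<-δ-in (suc N) y (λ j → δ (i ℕ.+ j) N) y<sN))) ⟩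
  Σ< (suc N) (λ i → δ x i * δ (i ℕ.+ y) N)
    ≡⟨ siftX ⟩
  δ (x ℕ.+ y) N ∎
  where
  siftX : Σ< (suc N) (λ i → δ x i * δ (i ℕ.+ y) N) ≡ δ (x ℕ.+ y) N
  siftX with x ℕP.<? suc N
  ... | yes x<sN = Σ<-δ-in (suc N) x (λ i → δ (i ℕ.+ y) N) x<sN
  ... | no x≮sN  = trans (Σ<-δ-out (suc N) x _ (ℕP.≮⇒≥ x≮sN))
                         (sym (δ-≢ (λ e → x≮sN (s≤s (subst (x ≤_) e (ℕP.m≤m+n x y))))))
... | no y≮sN = begin
  Σ< (suc N) (λ i → Σ< (suc N) (λ j → δ x i * (δ y j * δ (i ℕ.+ j) N)))
    ≡⟨ Σ<-zero (suc N) (λ i _ → trans (sym (Σ<-*ˡ (suc N) (δ x i) (λ j → δ y j * δ (i ℕ.+ j) N)))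
         (trans (cong (δ x i *_) (Σ<-δ-out (suc N) y (λ j → δ (i ℕ.+ j) N) (ℕP.≮⇒≥ y≮sN))) (ℚP.*-zeroʳ (δ x i)))) ⟩
  0ℚ
    ≡⟨ δ-≢ (λ e → y≮sN (s≤s (subst (y ≤_) e (ℕP.m≤n+m y x)))) ⟨
  δ (x ℕ.+ y) N ∎

δ-dilate : ∀ n N a b → Σ< (suc N) (λ d → δ (a ℕ.+ b) d * δ (suc n ℕ.* d) N) ≡ δ (suc n ℕ.* a ℕ.+ suc n ℕ.* b) N
δ-dilate n N a b with (a ℕ.+ b) ℕP.<? suc N
... | yes lt  = trans (Σ<-δ-in (suc N) (a ℕ.+ b) (λ d → δ (suc n ℕ.* d) N) lt)
                      (cong (λ z → δ z N) (ℕP.*-distribˡ-+ (suc n) a b))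
... | no nlt  = trans (Σ<-δ-out (suc N) (a ℕ.+ b) _ (ℕP.≮⇒≥ nlt))
  (sym (δ-≢ (λ e → nlt (s≤s (subst (a ℕ.+ b ≤_) (trans (ℕP.*-distribˡ-+ (suc n) a b) e) (ℕP.m≤n*m (a ℕ.+ b) (suc n)))))))

-- Both sides of the multiplicativity of dilation equal this box sum.
dilatedBox : ℕ → PowerSeries → PowerSeries → ℕ → ℚ
dilatedBox m φ ψ N = Σ< (suc N) (λ a → Σ< (suc N) (λ b → (φ a * ψ b) * δ (m ℕ.* a ℕ.+ m ℕ.* b) N))

dilate-*ₚ-box : ∀ n φ ψ N → (dilate (suc n) φ *ₚ dilate (suc n) ψ) N ≡ dilatedBox (suc n) φ ψ N
dilate-*ₚ-box n φ ψ N = begin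
  (dilate m φ *ₚ dilate m ψ) N
    ≡⟨ *ₚ-box (dilate m φ) (dilate m ψ) N N ℕP.≤-refl ⟩
  Σ< (suc N) (λ i → Σ< (suc N) (λ j → δ (i ℕ.+ j) N * (dilate m φ i * dilate m ψ j)))
    ≡⟨ Σ<-cong (suc N) (λ i i<sN → Σ<-cong (suc N) (λ j j<sN → expand i j (ℕP.≤-pred i<sN) (ℕP.≤-pred j<sN))) ⟩
  Σ< (suc N) (λ i → Σ< (suc N) (λ j → Σ< (suc N) (λ a → Σ< (suc N) (λ b →
     (φ a * ψ b) * (δ (m ℕ.* a) i * (δ (m ℕ.* b) j * δ (i ℕ.+ j) N))))))
    ≡⟨ Σ<-swap₂₂ (suc N) (suc N) (suc N) (suc N) _ ⟩
  Σ< (suc N) (λ a → Σ< (suc N) (λ b → Σ< (suc N) (λ i → Σ< (suc N) (λ j →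
     (φ a * ψ b) * (δ (m ℕ.* a) i * (δ (m ℕ.* b) j * δ (i ℕ.+ j) N))))))
    ≡⟨ Σ<-cong (suc N) (λ a _ → Σ<-cong (suc N) (λ b _ →
         trans (sym (Σ<²-*ˡ (suc N) (suc N) (φ a * ψ b) (λ i j → δ (m ℕ.* a) i * (δ (m ℕ.* b) j * δ (i ℕ.+ j) N))))
               (cong ((φ a * ψ b) *_) (δ-box N (m ℕ.* a) (m ℕ.* b))))) ⟩
  dilatedBox m φ ψ N ∎
  where
  m = suc n
  rearrange : ∀ a b c d e → a * ((b * c) * (d * e)) ≡ (c * e) * (b * (d * a))
  rearrange = solve-∀ ℚ-ring
  expand : ∀ i j → i ≤ N → j ≤ N → δ (i ℕ.+ j) N * (dilate m φ i * dilate m ψ j)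
    ≡ Σ< (suc N) (λ a → Σ< (suc N) (λ b → (φ a * ψ b) * (δ (m ℕ.* a) i * (δ (m ℕ.* b) j * δ (i ℕ.+ j) N))))
  expand i j i≤N j≤N = begin
    δ (i ℕ.+ j) N * (dilate m φ i * dilate m ψ j)
      ≡⟨ cong₂ (λ x y → δ (i ℕ.+ j) N * (x * y)) (dilate-range n φ i N i≤N) (dilate-range n ψ j N j≤N) ⟩
    δ (i ℕ.+ j) N * (Σ< (suc N) (λ a → δ (m ℕ.* a) i * φ a) * Σ< (suc N) (λ b → δ (m ℕ.* b) j * ψ b))
      ≡⟨ cong (δ (i ℕ.+ j) N *_) (Σ<-product (suc N) (suc N) _ _) ⟩
    δ (i ℕ.+ j) N * Σ< (suc N) (λ a → Σ< (suc N) (λ b → (δ (m ℕ.* a) i * φ a) * (δ (m ℕ.* b) j * ψ b)))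
      ≡⟨ Σ<²-*ˡ (suc N) (suc N) (δ (i ℕ.+ j) N) (λ a b → (δ (m ℕ.* a) i * φ a) * (δ (m ℕ.* b) j * ψ b)) ⟩
    Σ< (suc N) (λ a → Σ< (suc N) (λ b → δ (i ℕ.+ j) N * ((δ (m ℕ.* a) i * φ a) * (δ (m ℕ.* b) j * ψ b))))
      ≡⟨ Σ<-cong (suc N) (λ a _ → Σ<-cong (suc N) (λ b _ →
           rearrange (δ (i ℕ.+ j) N) (δ (m ℕ.* a) i) (φ a) (δ (m ℕ.* b) j) (ψ b))) ⟩
    Σ< (suc N) (λ a → Σ< (suc N) (λ b → (φ a * ψ b) * (δ (m ℕ.* a) i * (δ (m ℕ.* b) j * δ (i ℕ.+ j) N)))) ∎

dilate-box : ∀ n φ ψ N → dilate (suc n) (φ *ₚ ψ) N ≡ dilatedBox (suc n) φ ψ N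
dilate-box n φ ψ N = begin
  dilate m (φ *ₚ ψ) N
    ≡⟨ Σ<-cong (suc N) (λ d d<sN → expand d (ℕP.≤-pred d<sN)) ⟩
  Σ< (suc N) (λ d → Σ< (suc N) (λ a → Σ< (suc N) (λ b → (φ a * ψ b) * (δ (a ℕ.+ b) d * δ (m ℕ.* d) N))))
    ≡⟨ Σ<-swap₁₂ (suc N) (suc N) (suc N) _ ⟩
  Σ< (suc N) (λ a → Σ< (suc N) (λ b → Σ< (suc N) (λ d → (φ a * ψ b) * (δ (a ℕ.+ b) d * δ (m ℕ.* d) N))))
    ≡⟨ Σ<-cong (suc N) (λ a _ → Σ<-cong (suc N) (λ b _ →
         trans (sym (Σ<-*ˡ (suc N) (φ a * ψ b) _)) (cong ((φ a * ψ b) *_) (δ-dilate n N a b)))) ⟩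
  dilatedBox m φ ψ N ∎
  where
  m = suc n
  rearrange : ∀ a b c → a * (b * c) ≡ c * (b * a)
  rearrange = solve-∀ ℚ-ring
  expand : ∀ d → d ≤ N → δ (m ℕ.* d) N * (φ *ₚ ψ) d
    ≡ Σ< (suc N) (λ a → Σ< (suc N) (λ b → (φ a * ψ b) * (δ (a ℕ.+ b) d * δ (m ℕ.* d) N)))
  expand d d≤N = begin
    δ (m ℕ.* d) N * (φ *ₚ ψ) d
      ≡⟨ cong (δ (m ℕ.* d) N *_) (*ₚ-box φ ψ d N d≤N) ⟩
    δ (m ℕ.* d) N * Σ< (suc N) (λ a → Σ< (suc N) (λ b → δ (a ℕ.+ b) d * (φ a * ψ b)))
      ≡⟨ Σ<²-*ˡ (suc N) (suc N) (δ (m ℕ.* d) N) (λ a b → δ (a ℕ.+ b) d * (φ a * ψ b)) ⟩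
    Σ< (suc N) (λ a → Σ< (suc N) (λ b → δ (m ℕ.* d) N * (δ (a ℕ.+ b) d * (φ a * ψ b))))
      ≡⟨ Σ<-cong (suc N) (λ a _ → Σ<-cong (suc N) (λ b _ →
           rearrange (δ (m ℕ.* d) N) (δ (a ℕ.+ b) d) (φ a * ψ b))) ⟩
    Σ< (suc N) (λ a → Σ< (suc N) (λ b → (φ a * ψ b) * (δ (a ℕ.+ b) d * δ (m ℕ.* d) N))) ∎

dilate-*ₚ : ∀ n φ ψ → (dilate (suc n) φ *ₚ dilate (suc n) ψ) ≈ₚ dilate (suc n) (φ *ₚ ψ)
dilate-*ₚ n φ ψ N = trans (dilate-*ₚ-box n φ ψ N) (sym (dilate-box n φ ψ N))

G : ℕ → ℕ → PowerSeries
G u n = dilate n (qe u)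

combG : List (ℚ × ℕ) → ℕ → PowerSeries
combG []            n = zeroₚ
combG ((c , u) ∷ L) n = (c ·ₚ G u n) +ₚ combG L n

dilate-combQE : ∀ L n → dilate n (combQE L) ≈ₚ combG L n
dilate-combQE []            n x = Σ<-zero (suc x) (λ a _ → ℚP.*-zeroʳ (δ (n ℕ.* a) x))
dilate-combQE ((c , u) ∷ L) n x = begin
  Σ< (suc x) (λ a → δ (n ℕ.* a) x * (c * qe u a + combQE L a))
    ≡⟨ Σ<-cong (suc x) (λ a _ → ℚP.*-distribˡ-+ (δ (n ℕ.* a) x) _ _) ⟩
  Σ< (suc x) (λ a → δ (n ℕ.* a) x * (c * qe u a) + δ (n ℕ.* a) x * combQE L a)
    ≡⟨ Σ<-+ (suc x) _ _ ⟩
  Σ< (suc x) (λ a → δ (n ℕ.* a) x * (c * qe u a)) + dilate n (combQE L) x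
    ≡⟨ cong₂ _+_ (trans (Σ<-cong (suc x) (λ a _ → swap (δ (n ℕ.* a) x) c (qe u a))) (sym (Σ<-*ˡ (suc x) c _)))
                 (dilate-combQE L n x) ⟩
  c * G u n x + combG L n x ∎
  where
  swap : ∀ d c q → d * (c * q) ≡ c * (d * q)
  swap = solve-∀ ℚ-ring

productCoeffs : ℕ → ℕ → List (ℚ × ℕ)
productCoeffs (suc (suc k)) (suc (suc l)) = proj₁ (qe-convolution k l)
productCoeffs _             _             = []

productCoeffs-ge2 : ∀ {s t} → 2 ≤ s → 2 ≤ t → All WeightGe2 (productCoeffs s t)
productCoeffs-ge2 {suc (suc k)} {suc (suc l)} (s≤s (s≤s _)) (s≤s (s≤s _)) = proj₁ (proj₂ (qe-convolution k l))

G-product : ∀ {s t} → 2 ≤ s → 2 ≤ t → ∀ m → (G s (suc m) *ₚ G t (suc m)) ≈ₚ combG (productCoeffs s t) (suc m)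
G-product {suc (suc k)} {suc (suc l)} (s≤s (s≤s _)) (s≤s (s≤s _)) m =
  ≈ₚ-trans (dilate-*ₚ m (qe (suc (suc k))) (qe (suc (suc l))))
  (≈ₚ-trans (dilate-cong (suc m) (proj₂ (proj₂ (qe-convolution k l))))
            (dilate-combQE (proj₁ (qe-convolution k l)) (suc m)))

-- Truncated brackets C w m: their recursion in m, and stability C w m N =
-- bracket w N once m > N.

if-≤ᵇ : ∀ x N X {R : ℚ} → (x ≤ N → R ≡ X) → (¬ x ≤ N → R ≡ 0ℚ) → R ≡ (if x ≤ᵇ N then X else 0ℚ)
if-≤ᵇ x N X yes≤ no≤ with x ≤ᵇ N in eq
... | true  = yes≤ (ℕP.≤ᵇ⇒≤ x N (subst T (sym eq) _))
... | false = no≤ (λ le → subst T eq (ℕP.≤⇒≤ᵇ le))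

if-0 : ∀ (b : Bool) {X} → X ≡ 0ℚ → (if b then X else 0ℚ) ≡ 0ℚ
if-0 true  e = e
if-0 false e = refl

-- The coefficients of φ(q^n) · h, in the shape used by the definition of C.
dilate-*ₚ-coeff : ∀ n' φ h N → (dilate (suc n') φ *ₚ h) N
  ≡ Σ< (suc N) (λ a → if (suc n' ℕ.* a) ≤ᵇ N then φ a * h (N ∸ (suc n' ℕ.* a)) else 0ℚ)
dilate-*ₚ-coeff n' φ h N = begin
  (dilate n φ *ₚ h) N
    ≡⟨ *ₚ-coeff (dilate n φ) h N ⟩
  Σ< (suc N) (λ i → dilate n φ i * h (N ∸ i))
    ≡⟨ Σ<-cong (suc N) (λ i i<sN → trans (cong (_* h (N ∸ i)) (dilate-range n' φ i N (ℕP.≤-pred i<sN)))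
                                          (trans (Σ<-*ʳ (suc N) (h (N ∸ i)) _) (Σ<-cong (suc N) (λ a _ → assoc a i)))) ⟩
  Σ< (suc N) (λ i → Σ< (suc N) (λ a → δ (n ℕ.* a) i * (φ a * h (N ∸ i))))
    ≡⟨ Σ<-swap (suc N) (suc N) _ ⟩
  Σ< (suc N) (λ a → Σ< (suc N) (λ i → δ (n ℕ.* a) i * (φ a * h (N ∸ i))))
    ≡⟨ Σ<-cong (suc N) (λ a _ → if-≤ᵇ (n ℕ.* a) N (φ a * h (N ∸ (n ℕ.* a)))
         (λ le  → Σ<-δ-in (suc N) (n ℕ.* a) (λ i → φ a * h (N ∸ i)) (s≤s le))
         (λ nle → Σ<-δ-out (suc N) (n ℕ.* a) (λ i → φ a * h (N ∸ i)) (ℕP.≰⇒> nle))) ⟩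
  Σ< (suc N) (λ a → if (n ℕ.* a) ≤ᵇ N then φ a * h (N ∸ (n ℕ.* a)) else 0ℚ) ∎
  where
  n = suc n'
  assoc : ∀ a i → (δ (n ℕ.* a) i * φ a) * h (N ∸ i) ≡ δ (n ℕ.* a) i * (φ a * h (N ∸ i))
  assoc a i = ℚP.*-assoc (δ (n ℕ.* a) i) (φ a) (h (N ∸ i))

C-step : ∀ k w m → C (suc (suc k) ∷ w) (suc (suc m)) ≈ₚ (C (suc (suc k) ∷ w) (suc m) +ₚ (G (suc (suc k)) (suc m) *ₚ C w (suc m)))
C-step k w m N = cong (C (s ∷ w) (suc m) N +_) (sym (begin
  (G s n *ₚ h) N
    ≡⟨ dilate-*ₚ-coeff m (qe s) h N ⟩
  Σ< (suc N) term
    ≡⟨ Σ<-head N term ⟩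
  term 0 + Σ< N (λ a → term (suc a))
    ≡⟨ cong (_+ Σ< N (λ a → term (suc a))) (if-0 ((n ℕ.* 0) ≤ᵇ N) (trans (cong (_* h (N ∸ (n ℕ.* 0))) (qe-at0 k)) (ℚP.*-zeroˡ (h (N ∸ (n ℕ.* 0)))))) ⟩
  0ℚ + Σ< N (λ a → term (suc a))
    ≡⟨ ℚP.+-identityˡ _ ⟩
  Σ< N (λ a → term (suc a))
    ≡⟨ Σ<-cong N (λ a _ → cong (λ x → if (n ℕ.* suc a) ≤ᵇ N then x * h (N ∸ (n ℕ.* suc a)) else 0ℚ) (sym (coefQE≡qe s (suc a)))) ⟩
  Σ< N (λ a → if (n ℕ.* suc a) ≤ᵇ N then coefQE s (suc a) * h (N ∸ (n ℕ.* suc a)) else 0ℚ)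
    ≡⟨ sum1≡Σ< N _ ⟨
  sum1 N (λ d → if (n ℕ.* d) ≤ᵇ N then coefQE s d * h (N ∸ (n ℕ.* d)) else 0ℚ) ∎))
  where
  s = suc (suc k)
  n = suc m
  h = C w (suc m)
  term : ℕ → ℚ
  term a = if (n ℕ.* a) ≤ᵇ N then qe s a * h (N ∸ (n ℕ.* a)) else 0ℚ

C-stable-step : ∀ s w m N → N ≤ m → C (s ∷ w) (suc (suc m)) N ≡ C (s ∷ w) (suc m) N
C-stable-step s w m N N≤m = trans (cong (C (s ∷ w) (suc m) N +_) newTerms) (ℚP.+-identityʳ _)
  where
  newTerms : sum1 N (λ d → if (suc m ℕ.* d) ≤ᵇ N then coefQE s d * C w (suc m) (N ∸ (suc m ℕ.* d)) else 0ℚ) ≡ 0ℚ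
  newTerms = trans (sum1≡Σ< N _) (Σ<-zero N (λ a _ → sym (if-≤ᵇ (suc m ℕ.* suc a) N _ {0ℚ}
    (λ le → ⊥-elim (ℕP.<-irrefl refl (ℕP.≤-trans (ℕP.≤-trans (s≤s N≤m) (ℕP.m≤m*n (suc m) (suc a))) le)))
    (λ _ → refl))))

C-stable : ∀ w m N → N ≤ m → C w (suc m) N ≡ bracket w N
C-stable []      m N N≤m = refl
C-stable (s ∷ w) m N N≤m = trans (cong (λ x → C (s ∷ w) (suc x) N) (sym (ℕP.m∸n+n≡m N≤m))) (raise (m ∸ N))
  where
  raise : ∀ k → C (s ∷ w) (suc (k ℕ.+ N)) N ≡ C (s ∷ w) (suc N) N
  raise zero    = refl
  raise (suc k) = trans (C-stable-step s w (k ℕ.+ N) N (ℕP.m≤n+m N k)) (raise k)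

-- The stuffle product of truncated brackets.

WordComb : Set
WordComb = List (ℚ × List ℕ)

evalC : WordComb → ℕ → PowerSeries
evalC []            m = zeroₚ
evalC ((c , w) ∷ L) m = (c ·ₚ C w m) +ₚ evalC L m

prefix : ℕ → WordComb → WordComb
prefix u []            = []
prefix u ((c , w) ∷ L) = (c , u ∷ w) ∷ prefix u L

scaleWords : ℚ → WordComb → WordComb
scaleWords k []            = []
scaleWords k ((c , w) ∷ L) = (k * c , w) ∷ scaleWords k L

prefixComb : List (ℚ × ℕ) → WordComb → WordComb
prefixComb []            L = []
prefixComb ((c , u) ∷ M) L = prefix u (scaleWords c L) ++ prefixComb M L

-- The stuffle (quasi-shuffle) product, whose "contraction" of two letters
-- s, t is the combination given by the product formula g_s g_t = Σ c_u g_u: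
--   sv ∗ tw = s(v ∗ tw) + t(sv ∗ w) + Σ c_u u(v ∗ w).
stuffle : List ℕ → List ℕ → WordComb
stuffle []      w       = (1ℚ , w) ∷ []
stuffle (s ∷ v) []      = (1ℚ , s ∷ v) ∷ []
stuffle (s ∷ v) (t ∷ w) =
  prefix s (stuffle v (t ∷ w)) ++ prefix t (stuffle (s ∷ v) w) ++ prefixComb (productCoeffs s t) (stuffle v w)

evalC-++ : ∀ L L' m → evalC (L ++ L') m ≈ₚ (evalC L m +ₚ evalC L' m)
evalC-++ []            L' m N = sym (ℚP.+-identityˡ _)
evalC-++ ((c , w) ∷ L) L' m N =
  trans (cong (c * C w m N +_) (evalC-++ L L' m N)) (sym (ℚP.+-assoc (c * C w m N) (evalC L m N) (evalC L' m N)))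

evalC-scale : ∀ k L m → evalC (scaleWords k L) m ≈ₚ (k ·ₚ evalC L m)
evalC-scale k []            m N = sym (ℚP.*-zeroʳ k)
evalC-scale k ((c , w) ∷ L) m N =
  trans (cong ((k * c) * C w m N +_) (evalC-scale k L m N)) (distrib k c (C w m N) (evalC L m N))
  where
  distrib : ∀ k c x y → (k * c) * x + k * y ≡ k * (c * x + y)
  distrib = solve-∀ ℚ-ring

-- Truncation at 1 kills every nonempty word.
evalC-prefix-1 : ∀ u L → evalC (prefix u L) 1 ≈ₚ zeroₚ
evalC-prefix-1 u []            N = refl
evalC-prefix-1 u ((c , w) ∷ L) N = trans (cong₂ _+_ (ℚP.*-zeroʳ c) (evalC-prefix-1 u L N)) (ℚP.+-identityˡ 0ℚ)

evalC-prefixComb-1 : ∀ M L → evalC (prefixComb M L) 1 ≈ₚ zeroₚ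
evalC-prefixComb-1 []            L N = refl
evalC-prefixComb-1 ((c , u) ∷ M) L N = trans (evalC-++ (prefix u (scaleWords c L)) (prefixComb M L) 1 N)
  (trans (cong₂ _+_ (evalC-prefix-1 u (scaleWords c L) N) (evalC-prefixComb-1 M L N)) (ℚP.+-identityˡ 0ℚ))

evalC-prefix-step : ∀ u → 2 ≤ u → ∀ L m →
  evalC (prefix u L) (suc (suc m)) ≈ₚ (evalC (prefix u L) (suc m) +ₚ (G u (suc m) *ₚ evalC L (suc m)))
evalC-prefix-step u u≥2 [] m N = sym (trans (ℚP.+-identityˡ _) (*ₚ-zeroʳ (G u (suc m)) N))
evalC-prefix-step (suc (suc k)) u≥2@(s≤s (s≤s _)) ((c , w) ∷ L) m N = begin
  c * C (u ∷ w) (suc (suc m)) N + evalC (prefix u L) (suc (suc m)) N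
    ≡⟨ cong₂ (λ x y → c * x + y) (C-step k w m N) (evalC-prefix-step u u≥2 L m N) ⟩
  c * (C (u ∷ w) (suc m) N + (g *ₚ C w (suc m)) N) + (evalC (prefix u L) (suc m) N + (g *ₚ evalC L (suc m)) N)
    ≡⟨ rearrange c (C (u ∷ w) (suc m) N) ((g *ₚ C w (suc m)) N) (evalC (prefix u L) (suc m) N) ((g *ₚ evalC L (suc m)) N) ⟩
  (c * C (u ∷ w) (suc m) N + evalC (prefix u L) (suc m) N) + (c * (g *ₚ C w (suc m)) N + (g *ₚ evalC L (suc m)) N)
    ≡⟨ cong ((c * C (u ∷ w) (suc m) N + evalC (prefix u L) (suc m) N) +_)
         (sym (trans (*ₚ-distribˡ g (c ·ₚ C w (suc m)) (evalC L (suc m)) N)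
                     (cong (_+ (g *ₚ evalC L (suc m)) N) (*ₚ-scaleʳ c g (C w (suc m)) N)))) ⟩
  (c * C (u ∷ w) (suc m) N + evalC (prefix u L) (suc m) N) + (g *ₚ ((c ·ₚ C w (suc m)) +ₚ evalC L (suc m))) N ∎
  where
  u = suc (suc k)
  g = G u (suc m)
  rearrange : ∀ c x y z v → c * (x + y) + (z + v) ≡ (c * x + z) + (c * y + v)
  rearrange = solve-∀ ℚ-ring

evalC-prefixComb-step : ∀ M → All WeightGe2 M → ∀ L m →
  evalC (prefixComb M L) (suc (suc m)) ≈ₚ (evalC (prefixComb M L) (suc m) +ₚ (combG M (suc m) *ₚ evalC L (suc m)))
evalC-prefixComb-step [] [] L m N = sym (trans (ℚP.+-identityˡ _) (*ₚ-zeroˡ (evalC L (suc m)) N))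
evalC-prefixComb-step ((c , u) ∷ M) (u≥2 ∷ M≥2) L m N = begin
  evalC (prefix u (scaleWords c L) ++ prefixComb M L) (suc (suc m)) N
    ≡⟨ evalC-++ (prefix u (scaleWords c L)) (prefixComb M L) (suc (suc m)) N ⟩
  evalC (prefix u (scaleWords c L)) (suc (suc m)) N + evalC (prefixComb M L) (suc (suc m)) N
    ≡⟨ cong₂ _+_ (evalC-prefix-step u u≥2 (scaleWords c L) m N) (evalC-prefixComb-step M M≥2 L m N) ⟩
  (X1 + (G u (suc m) *ₚ evalC (scaleWords c L) (suc m)) N) + (X2 + Y2)
    ≡⟨ cong (λ x → (X1 + x) + (X2 + Y2))
         (trans (*ₚ-cong {G u (suc m)} (λ _ → refl) (evalC-scale c L (suc m)) N) (*ₚ-scaleʳ c (G u (suc m)) (evalC L (suc m)) N)) ⟩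
  (X1 + c * Y1) + (X2 + Y2)
    ≡⟨ rearrange X1 X2 c Y1 Y2 ⟩
  (X1 + X2) + (c * Y1 + Y2)
    ≡⟨ cong₂ _+_ (sym (evalC-++ (prefix u (scaleWords c L)) (prefixComb M L) (suc m) N))
         (sym (trans (*ₚ-distribʳ (evalC L (suc m)) (c ·ₚ G u (suc m)) (combG M (suc m)) N)
                     (cong (_+ Y2) (*ₚ-scaleˡ c (G u (suc m)) (evalC L (suc m)) N)))) ⟩
  evalC (prefix u (scaleWords c L) ++ prefixComb M L) (suc m) N + (combG ((c , u) ∷ M) (suc m) *ₚ evalC L (suc m)) N ∎
  where
  X1 = evalC (prefix u (scaleWords c L)) (suc m) N
  X2 = evalC (prefixComb M L) (suc m) N
  Y1 = (G u (suc m) *ₚ evalC L (suc m)) N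
  Y2 = (combG M (suc m) *ₚ evalC L (suc m)) N
  rearrange : ∀ x1 x2 c y1 y2 → (x1 + c * y1) + (x2 + y2) ≡ (x1 + x2) + (c * y1 + y2)
  rearrange = solve-∀ ℚ-ring

evalC-stuffle : ∀ s v t w m N → evalC (stuffle (s ∷ v) (t ∷ w)) m N
  ≡ evalC (prefix s (stuffle v (t ∷ w))) m N
    + (evalC (prefix t (stuffle (s ∷ v) w)) m N + evalC (prefixComb (productCoeffs s t) (stuffle v w)) m N)
evalC-stuffle s v t w m N =
  trans (evalC-++ (prefix s (stuffle v (t ∷ w))) _ m N)
        (cong (evalC (prefix s (stuffle v (t ∷ w))) m N +_) (evalC-++ (prefix t (stuffle (s ∷ v) w)) _ m N))

expand-product : ∀ a b p r e f → ((a +ₚ (e *ₚ p)) *ₚ (b +ₚ (f *ₚ r)))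
  ≈ₚ (((a *ₚ b) +ₚ (e *ₚ (p *ₚ b))) +ₚ ((f *ₚ (a *ₚ r)) +ₚ ((e *ₚ f) *ₚ (p *ₚ r))))
expand-product a b p r e f =
  ≈ₚ-trans (*ₚ-distribˡ (a +ₚ (e *ₚ p)) b (f *ₚ r))
  (+ₚ-cong (≈ₚ-trans (*ₚ-distribʳ b a (e *ₚ p)) (+ₚ-cong {a *ₚ b} {a *ₚ b} (λ _ → refl) (*ₚ-assoc e p b)))
           (≈ₚ-trans (*ₚ-distribʳ (f *ₚ r) a (e *ₚ p)) (+ₚ-cong (exchange a f r) middleFour)))
  where
  exchange : ∀ x y z → (x *ₚ (y *ₚ z)) ≈ₚ (y *ₚ (x *ₚ z))
  exchange x y z = ≈ₚ-trans (≈ₚ-sym (*ₚ-assoc x y z)) (≈ₚ-trans (*ₚ-cong (*ₚ-comm x y) (λ _ → refl)) (*ₚ-assoc y x z))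
  middleFour : ((e *ₚ p) *ₚ (f *ₚ r)) ≈ₚ ((e *ₚ f) *ₚ (p *ₚ r))
  middleFour = ≈ₚ-trans (*ₚ-assoc e p (f *ₚ r))
               (≈ₚ-trans (*ₚ-cong {e} (λ _ → refl) (exchange p f r)) (≈ₚ-sym (*ₚ-assoc e f (p *ₚ r))))

C-stuffle : ∀ k v w → All GreaterOne v → All GreaterOne w → (C v (suc k) *ₚ C w (suc k)) ≈ₚ evalC (stuffle v w) (suc k)
C-stuffle k       []      w       _ _ N = trans (*ₚ-identityˡ (C w (suc k)) N) (sym (trans (ℚP.+-identityʳ _) (ℚP.*-identityˡ _)))
C-stuffle k       (s ∷ v) []      _ _ N = trans (*ₚ-identityʳ (C (s ∷ v) (suc k)) N) (sym (trans (ℚP.+-identityʳ _) (ℚP.*-identityˡ _)))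
C-stuffle zero    (s ∷ v) (t ∷ w) _ _ N = begin
  (zeroₚ *ₚ C (t ∷ w) 1) N ≡⟨ *ₚ-zeroˡ (C (t ∷ w) 1) N ⟩
  0ℚ                       ≡⟨ sym (trans (evalC-stuffle s v t w 1 N) (trans (cong₂ _+_ (evalC-prefix-1 s (stuffle v (t ∷ w)) N)
                                (trans (cong₂ _+_ (evalC-prefix-1 t (stuffle (s ∷ v) w) N) (evalC-prefixComb-1 (productCoeffs s t) (stuffle v w) N)) (ℚP.+-identityˡ 0ℚ)))
                                (ℚP.+-identityˡ 0ℚ))) ⟩
  evalC (stuffle (s ∷ v) (t ∷ w)) 1 N ∎
C-stuffle (suc k) (suc (suc ks) ∷ v) (suc (suc kt) ∷ w) (s≥2@(s≤s (s≤s _)) ∷ v≥2) (t≥2@(s≤s (s≤s _)) ∷ w≥2) N = begin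
  (C A (suc (suc k)) *ₚ C B (suc (suc k))) N
    ≡⟨ *ₚ-cong (C-step ks v k) (C-step kt w k) N ⟩
  ((a +ₚ (e *ₚ p)) *ₚ (b +ₚ (f *ₚ r))) N
    ≡⟨ expand-product a b p r e f N ⟩
  ((a *ₚ b) N + (e *ₚ (p *ₚ b)) N) + ((f *ₚ (a *ₚ r)) N + ((e *ₚ f) *ₚ (p *ₚ r)) N)
    ≡⟨ cong (λ z → (z + (e *ₚ (p *ₚ b)) N) + ((f *ₚ (a *ₚ r)) N + ((e *ₚ f) *ₚ (p *ₚ r)) N))
            (trans (C-stuffle k A B (s≥2 ∷ v≥2) (t≥2 ∷ w≥2) N) (evalC-stuffle s v t w (suc k) N)) ⟩
  ((X1 + (X2 + X3)) + (e *ₚ (p *ₚ b)) N) + ((f *ₚ (a *ₚ r)) N + ((e *ₚ f) *ₚ (p *ₚ r)) N)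
    ≡⟨ rearrange X1 X2 X3 _ _ _ ⟩
  (X1 + (e *ₚ (p *ₚ b)) N) + ((X2 + (f *ₚ (a *ₚ r)) N) + (X3 + ((e *ₚ f) *ₚ (p *ₚ r)) N))
    ≡⟨ cong₂ (λ x y → (X1 + x) + y)
         (*ₚ-cong {e} (λ _ → refl) (C-stuffle k v B v≥2 (t≥2 ∷ w≥2)) N)
         (cong₂ (λ x y → (X2 + x) + (X3 + y))
           (*ₚ-cong {f} (λ _ → refl) (C-stuffle k A w (s≥2 ∷ v≥2) w≥2) N)
           (*ₚ-cong (G-product s≥2 t≥2 k) (C-stuffle k v w v≥2 w≥2) N)) ⟩
  (X1 + (e *ₚ evalC L1 (suc k)) N) + ((X2 + (f *ₚ evalC L2 (suc k)) N) + (X3 + (combG M (suc k) *ₚ evalC L3 (suc k)) N))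
    ≡⟨ sym (cong₂ _+_ (evalC-prefix-step s s≥2 L1 k N)
                      (cong₂ _+_ (evalC-prefix-step t t≥2 L2 k N) (evalC-prefixComb-step M (productCoeffs-ge2 s≥2 t≥2) L3 k N))) ⟩
  evalC (prefix s L1) (suc (suc k)) N + (evalC (prefix t L2) (suc (suc k)) N + evalC (prefixComb M L3) (suc (suc k)) N)
    ≡⟨ evalC-stuffle s v t w (suc (suc k)) N ⟨
  evalC (stuffle A B) (suc (suc k)) N ∎
  where
  s = suc (suc ks)
  t = suc (suc kt)
  A = s ∷ v
  B = t ∷ w
  a = C A (suc k)
  b = C B (suc k)
  p = C v (suc k)
  r = C w (suc k)
  e = G s (suc k)
  f = G t (suc k)
  L1 = stuffle v B
  L2 = stuffle A w
  L3 = stuffle v w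
  M = productCoeffs s t
  X1 = evalC (prefix s L1) (suc k) N
  X2 = evalC (prefix t L2) (suc k) N
  X3 = evalC (prefixComb M L3) (suc k) N
  rearrange : ∀ x1 x2 x3 y1 y2 y3 → ((x1 + (x2 + x3)) + y1) + (y2 + y3) ≡ (x1 + y1) + ((x2 + y2) + (x3 + y3))
  rearrange = solve-∀ ℚ-ring

LettersGe2 : ℚ × List ℕ → Set
LettersGe2 (_ , w) = All GreaterOne w

prefix-ge2 : ∀ u L → GreaterOne u → All LettersGe2 L → All LettersGe2 (prefix u L)
prefix-ge2 u []            _   []       = []
prefix-ge2 u ((c , w) ∷ L) u≥2 (w≥2 ∷ L≥2) = (u≥2 ∷ w≥2) ∷ prefix-ge2 u L u≥2 L≥2

scaleWords-ge2 : ∀ k L → All LettersGe2 L → All LettersGe2 (scaleWords k L)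
scaleWords-ge2 k []            []          = []
scaleWords-ge2 k ((c , w) ∷ L) (w≥2 ∷ L≥2) = w≥2 ∷ scaleWords-ge2 k L L≥2

prefixComb-ge2 : ∀ M L → All WeightGe2 M → All LettersGe2 L → All LettersGe2 (prefixComb M L)
prefixComb-ge2 []            L []          L≥2 = []
prefixComb-ge2 ((c , u) ∷ M) L (u≥2 ∷ M≥2) L≥2 =
  AllP.++⁺ (prefix-ge2 u _ u≥2 (scaleWords-ge2 c L L≥2)) (prefixComb-ge2 M L M≥2 L≥2)

stuffle-ge2 : ∀ v w → All GreaterOne v → All GreaterOne w → All LettersGe2 (stuffle v w)
stuffle-ge2 []      w       _   w≥2 = w≥2 ∷ []
stuffle-ge2 (s ∷ v) []      v≥2 _   = v≥2 ∷ []
stuffle-ge2 (s ∷ v) (t ∷ w) (s≥2 ∷ v≥2) (t≥2 ∷ w≥2) =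
  AllP.++⁺ (prefix-ge2 s _ s≥2 (stuffle-ge2 v (t ∷ w) v≥2 (t≥2 ∷ w≥2)))
    (AllP.++⁺ (prefix-ge2 t _ t≥2 (stuffle-ge2 (s ∷ v) w (s≥2 ∷ v≥2) w≥2))
              (prefixComb-ge2 (productCoeffs s t) (stuffle v w) (productCoeffs-ge2 s≥2 t≥2) (stuffle-ge2 v w v≥2 w≥2)))

asBrackets : WordComb → List (ℚ × PowerSeries)
asBrackets []            = []
asBrackets ((c , w) ∷ L) = (c , bracket w) ∷ asBrackets L

evalC-asBrackets : ∀ L N → evalC L (suc N) N ≡ linComb (asBrackets L) N
evalC-asBrackets []            N = refl
evalC-asBrackets ((c , w) ∷ L) N = cong (c * C w (suc N) N +_) (evalC-asBrackets L N)

bracket-product : ∀ v w → All GreaterOne v → All GreaterOne w →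
  (bracket v *ₚ bracket w) ≈ₚ linComb (asBrackets (stuffle v w))
bracket-product v w v≥2 w≥2 N = begin
  (bracket v *ₚ bracket w) N
    ≡⟨ *ₚ-coeff (bracket v) (bracket w) N ⟩
  Σ< (suc N) (λ i → bracket v i * bracket w (N ∸ i))
    ≡⟨ Σ<-cong (suc N) (λ i i<sN → sym (cong₂ _*_ (C-stable v N i (ℕP.≤-pred i<sN)) (C-stable w N (N ∸ i) (ℕP.m∸n≤m N i)))) ⟩
  Σ< (suc N) (λ i → C v (suc N) i * C w (suc N) (N ∸ i))
    ≡⟨ *ₚ-coeff (C v (suc N)) (C w (suc N)) N ⟨
  (C v (suc N) *ₚ C w (suc N)) N
    ≡⟨ C-stuffle N v w v≥2 w≥2 N ⟩
  evalC (stuffle v w) (suc N) N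
    ≡⟨ evalC-asBrackets (stuffle v w) N ⟩
  linComb (asBrackets (stuffle v w)) N ∎

module _ (Gen : PowerSeries → Set) where

  private
    GenTerm : ℚ × PowerSeries → Set
    GenTerm (_ , g) = Gen g

  Span-cong : ∀ {f f'} → f ≈ₚ f' → Span Gen f → Span Gen f'
  Span-cong e (cs , A , p) = cs , A , λ N → trans (sym (e N)) (p N)

  Span-gen : ∀ {g} → Gen g → Span Gen g
  Span-gen {g} Gg = (1ℚ , g) ∷ [] , Gg ∷ [] , λ N → sym (trans (ℚP.+-identityʳ _) (ℚP.*-identityˡ _))

  Span-+ : ∀ {f g} → Span Gen f → Span Gen g → Span Gen (f +ₚ g)
  Span-+ (cs , A , p) (ds , B , q) = cs ++ ds , AllP.++⁺ A B , λ N → trans (cong₂ _+_ (p N) (q N)) (sym (linComb-++ cs ds N))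
    where
    linComb-++ : ∀ cs ds → linComb (cs ++ ds) ≈ₚ (linComb cs +ₚ linComb ds)
    linComb-++ []            ds N = sym (ℚP.+-identityˡ _)
    linComb-++ ((c , g) ∷ cs) ds N = trans (cong (c * g N +_) (linComb-++ cs ds N)) (sym (ℚP.+-assoc (c * g N) _ _))

  Span-scale : ∀ k {f} → Span Gen f → Span Gen (k ·ₚ f)
  Span-scale k (cs , A , p) = scaleS cs , scaleS-gen cs A , λ N → trans (cong (k *_) (p N)) (sym (linComb-scale cs N))
    where
    scaleS : List (ℚ × PowerSeries) → List (ℚ × PowerSeries)
    scaleS []             = []
    scaleS ((c , g) ∷ cs) = (k * c , g) ∷ scaleS cs
    scaleS-gen : ∀ cs → All GenTerm cs → All GenTerm (scaleS cs)
    scaleS-gen []             []      = []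
    scaleS-gen ((c , g) ∷ cs) (a ∷ A) = a ∷ scaleS-gen cs A
    distrib : ∀ k c x y → (k * c) * x + k * y ≡ k * (c * x + y)
    distrib = solve-∀ ℚ-ring
    linComb-scale : ∀ cs → linComb (scaleS cs) ≈ₚ (k ·ₚ linComb cs)
    linComb-scale []             N = sym (ℚP.*-zeroʳ k)
    linComb-scale ((c , g) ∷ cs) N = trans (cong ((k * c) * g N +_) (linComb-scale cs N)) (distrib k c (g N) (linComb cs N))

  Span-*ₚ : (∀ x y → Gen x → Gen y → Span Gen (x *ₚ y)) → ∀ {f g} → Span Gen f → Span Gen g → Span Gen (f *ₚ g)
  Span-*ₚ gen* {f} {g} (cs , A , p) (ds , B , q) =
    Span-cong (λ N → sym (*ₚ-cong p q N))
      (times (linComb ds) cs A (λ x Gx →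
        Span-cong (*ₚ-comm (linComb ds) x)
          (times x ds B (λ y Gy → Span-cong (*ₚ-comm x y) (gen* x y Gx Gy)))))
    where
    times : ∀ h cs → All GenTerm cs → (∀ g → Gen g → Span Gen (g *ₚ h)) → Span Gen (linComb cs *ₚ h)
    times h []             []      _  = Span-cong (≈ₚ-sym (*ₚ-zeroˡ h)) ([] , [] , λ _ → refl)
    times h ((c , g) ∷ cs) (a ∷ A) gh =
      Span-cong (≈ₚ-sym (≈ₚ-trans (*ₚ-distribʳ h (c ·ₚ g) (linComb cs)) (+ₚ-cong (*ₚ-scaleˡ c g h) (λ _ → refl))))
        (Span-+ (Span-scale c (gh g a)) (times h cs A gh))

Span-mono : ∀ {Gen Gen' : PowerSeries → Set} → (∀ g → Gen g → Gen' g) → ∀ f → Span Gen f → Span Gen' f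
Span-mono {Gen} {Gen'} mono f (cs , A , p) = cs , weaken cs A , p
  where
  weaken : ∀ cs → All (λ { (_ , g) → Gen g }) cs → All (λ { (_ , g) → Gen' g }) cs
  weaken []             []      = []
  weaken ((c , g) ∷ cs) (a ∷ A) = mono g a ∷ weaken cs A

SharpGen : PowerSeries → Set
SharpGen g = (g ≈ₚ oneₚ) ⊎ (Σ (List ℕ) λ ss → (1 ≤ length ss) × All GreaterOne ss × (g ≈ₚ bracket ss))

Ge2Bracket : PowerSeries → Set
Ge2Bracket g = Σ (List ℕ) λ ss → All GreaterOne ss × (g ≈ₚ bracket ss)

-- The two generating families agree: bracket [] = 1.
Ge2Bracket⇒SharpGen : ∀ g → Ge2Bracket g → SharpGen g
Ge2Bracket⇒SharpGen g ([]     , _   , e) = inj₁ e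
Ge2Bracket⇒SharpGen g (s ∷ ss , ss≥2 , e) = inj₂ (s ∷ ss , s≤s z≤n , ss≥2 , e)

SharpGen⇒Ge2Bracket : ∀ g → SharpGen g → Ge2Bracket g
SharpGen⇒Ge2Bracket g (inj₁ e)                  = [] , [] , e
SharpGen⇒Ge2Bracket g (inj₂ (ss , _ , ss≥2 , e)) = ss , ss≥2 , e

Ge2Bracket⇒Bracket : ∀ g → Ge2Bracket g → Σ (List ℕ) λ ss → All Positive ss × (g ≈ₚ bracket ss)
Ge2Bracket⇒Bracket g (ss , ss≥2 , e) = ss , All.map ℕP.<⇒≤ ss≥2 , e

SharpGen-*ₚ : ∀ x y → SharpGen x → SharpGen y → Span SharpGen (x *ₚ y)
SharpGen-*ₚ x y Gx Gy with SharpGen⇒Ge2Bracket x Gx | SharpGen⇒Ge2Bracket y Gy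
... | v , v≥2 , x≈v | w , w≥2 , y≈w =
  Span-cong SharpGen (≈ₚ-sym (≈ₚ-trans (*ₚ-cong x≈v y≈w) (bracket-product v w v≥2 w≥2)))
    (asBrackets (stuffle v w) , generators (stuffle v w) (stuffle-ge2 v w v≥2 w≥2) , λ N → refl)
  where
  generators : ∀ L → All LettersGe2 L → All (λ { (_ , g) → SharpGen g }) (asBrackets L)
  generators []            []            = []
  generators ((c , w) ∷ L) (w≥2 ∷ L≥2) = Ge2Bracket⇒SharpGen (bracket w) (w , w≥2 , λ _ → refl) ∷ generators L L≥2

mainTheorem2 :
    (∀ f → MDsharp f → Z GreaterOne f)
    × (∀ f → Z GreaterOne f → MDsharp f)
    × (∀ f → MDsharp f → MD f)
    × MDsharp oneₚ
    × (∀ f g → MDsharp f → MDsharp g → MDsharp (f +ₚ g))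
    × (∀ (c : ℚ) f → MDsharp f → MDsharp (c ·ₚ f))
    × (∀ f g → MDsharp f → MDsharp g → MDsharp (f *ₚ g))
mainTheorem2 =
    Span-mono SharpGen⇒Ge2Bracket
  , Span-mono Ge2Bracket⇒SharpGen
  , Span-mono (λ g Gg → Ge2Bracket⇒Bracket g (SharpGen⇒Ge2Bracket g Gg))
  , Span-gen SharpGen (inj₁ (λ _ → refl))
  , (λ f g → Span-+ SharpGen)
  , (λ c f → Span-scale SharpGen c)
  , (λ f g → Span-*ₚ SharpGen SharpGen-*ₚ)
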